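{- Let $F$ be a relevant collection with $\alpha(F)=\alpha$. The following are equivalent: (1) $F$ is a maximal hke collection; (2) $|\bigcup F|=2\alpha$ and there is an equivalence relation on $\bigcup F$ with exactly $\alpha$ equivalence classes, each having exactly two elements, such that $F$ equals the collection of all subsets $B\subseteq\bigcup F$ with $|B|=\alpha$ that intersect every equivalence class; (3) $|\bigcup F|=2\alpha$, the relation $\approx_F$ is an equivalence relation with exactly $\alpha$ equivalence classes, each having exactly two elements, and $F$ equals the collection of all subsets $B\subseteq\bigcup F$ with $|B|=\alpha$ that intersect every $\approx_F$-equivalence class.
   Context: A \emph{relevant collection} is a non-empty finite collection of finite sets all having the same positive cardinality $\alpha(F)$. $F$ is an \emph{hke collection} if there is a positive integer $\alpha$ such that $|\bigcup \Gamma|+|\bigcap \Gamma|=2\alpha$ for every non-empty subcollection $\Gamma\subseteq F$; it is \emph{maximal} if there is no hke collection $F'$ with $F\subsetneq F'$. The relation $\approx_F$ on $\bigcup F$ is defined by: $x\approx_F y$ iff $x=y$, or there exist $A,D\in F$ with $A-D=\{x\}$ and $D-A=\{y\}$. -}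

module Defs where

open import Level using (_⊔_)
open import Data.Nat using (ℕ; _+_; _*_; _<_)
open import Data.List using (List; []; _∷_; length)
open import Data.List.Membership.Propositional using (_∈_; _∉_)
open import Data.List.Relation.Unary.Any using (Any)
open import Data.List.Relation.Unary.All using (All)
open import Data.List.Relation.Unary.Unique.Propositional using (Unique)
open import Data.List.Relation.Unary.AllPairs using (AllPairs)
open import Data.Product using (Σ; ∃; ∃-syntax; _×_)
open import Data.Sum using (_⊎_)
open import Relation.Nullary using (¬_)
open import Relation.Binary.PropositionalEquality using (_≡_; _≢_)

_⇔′_ : ∀ {a b} → Set a → Set b → Set (a ⊔ b)
P ⇔′ Q = (P → Q) × (Q → P)
infix 3 _⇔′_

-- Elements are natural numbers (an infinite ground universe).
-- A finite set is represented by a list; the set is its set of members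
-- (duplicates / order irrelevant).
FinSet : Set
FinSet = List ℕ

Collection : Set
Collection = List FinSet

Pred : Set₁
Pred = ℕ → Set

HasCard : Pred → ℕ → Set
HasCard P n = Σ (List ℕ) λ xs → Unique xs × (∀ x → (x ∈ xs ⇔′ P x)) × (length xs ≡ n)

_≐_ : FinSet → FinSet → Set
A ≐ B = ∀ x → (x ∈ A ⇔′ x ∈ B)

-- Membership of a set in a collection (up to set equality).
_∈ᶜ_ : FinSet → Collection → Set
A ∈ᶜ F = Any (λ B → A ≐ B) F

_⊆ᶜ_ : Collection → Collection → Set
Γ ⊆ᶜ F = ∀ A → A ∈ᶜ Γ → A ∈ᶜ F

_⊊ᶜ_ : Collection → Collection → Set
F ⊊ᶜ F' = (F ⊆ᶜ F') × (Σ FinSet λ A → A ∈ᶜ F' × ¬ (A ∈ᶜ F))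

⋃ : Collection → Pred
⋃ Γ x = Any (λ A → x ∈ A) Γ

⋂ : Collection → Pred
⋂ Γ x = All (λ A → x ∈ A) Γ

Relevant : Collection → ℕ → Set
Relevant F α = (F ≢ []) × (0 < α) × (∀ A → A ∈ᶜ F → HasCard (_∈ A) α)

HkeWith : Collection → ℕ → Set
HkeWith F α = (0 < α) ×
  (∀ Γ → Γ ≢ [] → Γ ⊆ᶜ F →
     Σ ℕ λ u → Σ ℕ λ i → HasCard (⋃ Γ) u × HasCard (⋂ Γ) i × (u + i ≡ 2 * α))

Hke : Collection → Set
Hke F = Σ ℕ λ α → HkeWith F α

MaximalHke : Collection → Set
MaximalHke F = Hke F × (∀ F' → Hke F' → ¬ (F ⊊ᶜ F'))

IsEquivOn : Pred → (ℕ → ℕ → Set) → Set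
IsEquivOn U R =
  (∀ x → U x → R x x) ×
  (∀ x y → U x → U y → R x y → R y x) ×
  (∀ x y z → U x → U y → U z → R x y → R y z → R x z)

-- R (an equivalence relation on U) has exactly k equivalence classes:
-- there is a list of k pairwise non-equivalent representatives in U
-- such that every element of U is equivalent to one of them.
NumClasses : Pred → (ℕ → ℕ → Set) → ℕ → Set
NumClasses U R k = Σ (List ℕ) λ reps →
  All U reps × AllPairs (λ x y → ¬ R x y) reps ×
  (∀ x → U x → Any (λ r → R x r) reps) × (length reps ≡ k)

ClassesOfSizeTwo : Pred → (ℕ → ℕ → Set) → Set
ClassesOfSizeTwo U R = ∀ x → U x → HasCard (λ y → U y × R x y) 2

IsTransversalFamily : Collection → Pred → (ℕ → ℕ → Set) → ℕ → Set
IsTransversalFamily F U R α = ∀ B →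
  (B ∈ᶜ F ⇔′ ((∀ x → x ∈ B → U x) × HasCard (_∈ B) α ×
               (∀ x → U x → ∃[ y ] (y ∈ B × R x y))))

DiffIsSingleton : FinSet → FinSet → ℕ → Set
DiffIsSingleton A D x = ∀ z → ((z ∈ A × z ∉ D) ⇔′ z ≡ x)

≈[_] : Collection → ℕ → ℕ → Set
≈[ F ] x y = (x ≡ y) ⊎
  (Σ FinSet λ A → Σ FinSet λ D → A ∈ F × D ∈ F ×
     DiffIsSingleton A D x × DiffIsSingleton D A y)

-- A pairing P of α disjoint pairs determines its transversal family: the sets containing exactly one
-- element of each pair.  This family is hke with constant α, since every pair contributes exactly 2 to
-- |⋃ Γ| + |⋂ Γ|, and it is maximal, since a non-transversal A together with two transversals chosen
-- according to how A meets the pairs violates the identity.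
-- Conversely, the members of an hke collection F are transversals of some pairing with α pairs.  Points of
-- ⋂ F get fresh partners; the other points of ⋃ F are paired off one pair at a time.  Among the
-- signatures σ x = {A ∈ F ∣ x ∈ A} and their complements take one, W, of maximal size: the identity for
-- the subcollection selected by W balances the points whose signature contains W against those whose
-- complementary signature does, and this produces two points with complementary signatures.  Removing them
-- preserves the identity with α − 1 in place of α.
-- Hence a maximal F is the whole transversal family, ⋃ F consists of the 2α paired points, and the pairs
-- are the classes in (2).  Two transversals that differ exactly on one pair show that these classes are
-- also those of ≈_F, which gives (3).

module Submission where

open import Defs
open import Data.Nat using (ℕ; zero; suc; _+_; _*_; _∸_; _≤_; _<_; z≤n; s≤s; _≟_)
open import Algebra.Properties.CommutativeSemigroup as CommutativeSemigroupProperties using ()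
open import Data.Bool using (Bool; true; false; not; _∧_; _∨_; if_then_else_; T; T?)
open import Data.Bool.Properties using (T-≡; not-involutive; not-¬)
open import Data.Empty using (⊥-elim)
open import Data.List using (List; []; _∷_; length; map; _++_; concat; filter; filterᵇ; deduplicate)
open import Data.List.Membership.DecPropositional _≟_ using (_∈?_)
open import Data.List.Membership.Propositional using (_∈_; _∉_; find; lose)
open import Data.List.Membership.Propositional.Properties
  using (∈-filter⁺; ∈-filter⁻; ∈-map⁺; ∈-map⁻; ∈-++⁺ˡ; ∈-++⁺ʳ; ∈-concat⁺; ∈-concat⁻;
         ∈-deduplicate⁺; ∈-deduplicate⁻)
open import Data.List.Properties
  using (length-map; length-++; map-∘; map-cong; map-id; ∷-injectiveˡ; ∷-injectiveʳ;
         filter-notAll; filter-all; filter-none; filter-some; filter-accept; filter-reject; filter-≐)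
open import Data.List.Relation.Binary.Subset.Propositional using (_⊆_)
open import Data.List.Relation.Binary.Subset.DecPropositional _≟_ using (_⊆?_)
open import Data.List.Relation.Unary.All as All using (All; []; _∷_)
import Data.List.Relation.Unary.All.Properties as All
open import Data.List.Relation.Unary.All.Properties using (¬All⇒Any¬)
open import Data.List.Relation.Unary.AllPairs using (AllPairs; []; _∷_)
open import Data.List.Relation.Unary.Any as Any using (Any; here; there; any?)
open import Data.List.Relation.Unary.Unique.Propositional using (Unique)
import Data.List.Relation.Unary.Unique.Propositional.Properties as Unique
open import Data.List.Relation.Unary.Unique.DecPropositional.Properties _≟_ using (deduplicate-!)
open import Data.Nat.ListAction using (sum)
open import Data.Nat.Properties
  using (≤-antisym; ≤-trans; ≤-pred; m≤n⇒m≤1+n; <-irrefl; suc-injective; +-suc; +-assoc; +-comm; +-identityʳ;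
         +-mono-≤; m≤m+n; m≤n+m; n<1+n; *-suc; +-cancelˡ-≡; +-cancelʳ-≡; m+n∸n≡m; m∸n+n≡m; *-distribˡ-∸;
         *-cancelˡ-≤; <⇒≢; <-≤-trans; ≤-totalOrder; +-commutativeSemigroup; module ≤-Reasoning)
open import Data.List.Extrema ≤-totalOrder using (argmax; argmax-all; f[xs]≤f[argmax]; max; xs≤max)
open import Data.Product using (Σ; ∃; ∃-syntax; _×_; _,_; proj₁; proj₂)
open import Data.Sum using (_⊎_; inj₁; inj₂)
open import Function using (_∘_; Equivalence)
open import Relation.Nullary using (¬_; ¬?; Dec; yes; no; does)
open import Relation.Nullary.Decidable using (dec-true; dec-false; map′; _×-dec_)
open import Relation.Binary.PropositionalEquality

open CommutativeSemigroupProperties +-commutativeSemigroup using (interchange; x∙yz≈y∙xz)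

-- Cardinalities and counting

Unique-length-≤ : {xs ys : List ℕ} → Unique xs → xs ⊆ ys → length xs ≤ length ys
Unique-length-≤ {[]} _ _ = z≤n
Unique-length-≤ {x ∷ xs} {ys} (x∉xs ∷ !xs) x∷xs⊆ys = begin-strict
  length xs                      ≤⟨ Unique-length-≤ !xs xs⊆ys∖x ⟩
  length (filter ≢x? ys)         <⟨ filter-notAll ≢x? ys (Any.map (λ x≡y x≢y → x≢y x≡y) (x∷xs⊆ys (here refl))) ⟩
  length ys                      ∎
  where
  open ≤-Reasoning
  ≢x? = λ y → ¬? (x ≟ y)
  xs⊆ys∖x : xs ⊆ filter ≢x? ys
  xs⊆ys∖x y∈xs = ∈-filter⁺ ≢x? (x∷xs⊆ys (there y∈xs)) (All.lookup x∉xs y∈xs)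

HasCard-mono : {P Q : Pred} {m n : ℕ} → (∀ x → P x → Q x) → HasCard P m → HasCard Q n → m ≤ n
HasCard-mono P⊆Q (xs , !xs , xs≡P , refl) (ys , _ , ys≡Q , refl) =
  Unique-length-≤ !xs (λ {x} x∈xs → proj₂ (ys≡Q x) (P⊆Q x (proj₁ (xs≡P x) x∈xs)))

HasCard-unique : {P : Pred} {m n : ℕ} → HasCard P m → HasCard P n → m ≡ n
HasCard-unique c d = ≤-antisym (HasCard-mono (λ _ p → p) c d) (HasCard-mono (λ _ p → p) d c)

HasCard-cong : {P Q : Pred} {m : ℕ} → (∀ x → P x ⇔′ Q x) → HasCard P m → HasCard Q m
HasCard-cong P⇔Q (xs , !xs , xs≡P , l) =
  xs , !xs , (λ x → (λ x∈xs → proj₁ (P⇔Q x) (proj₁ (xs≡P x) x∈xs)) ,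
                    (λ Qx → proj₂ (xs≡P x) (proj₂ (P⇔Q x) Qx))) , l

HasCard-list : {xs : List ℕ} → Unique xs → HasCard (_∈ xs) (length xs)
HasCard-list {xs} !xs = xs , !xs , (λ _ → (λ p → p) , (λ p → p)) , refl

HasCard-empty : {P : Pred} → (∀ x → ¬ P x) → HasCard P 0
HasCard-empty ¬P = [] , [] , (λ x → (λ ()) , (λ p → ⊥-elim (¬P x p))) , refl

HasCard-singleton : (a : ℕ) → HasCard (_≡ a) 1
HasCard-singleton a = HasCard-cong (λ x → (λ { (here x≡a) → x≡a ; (there ()) }) , here) (HasCard-list ([] ∷ []))

HasCard-insert : {P : Pred} {n : ℕ} (b : ℕ) → ¬ P b → HasCard P n → HasCard (λ x → x ≡ b ⊎ P x) (suc n)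
HasCard-insert {P} b ¬Pb (xs , !xs , xs≡P , l) =
  b ∷ xs , All.tabulate (λ {y} y∈xs b≡y → ¬Pb (subst P (sym b≡y) (proj₁ (xs≡P y) y∈xs))) ∷ !xs ,
  (λ x → (λ { (here x≡b) → inj₁ x≡b ; (there x∈xs) → inj₂ (proj₁ (xs≡P x) x∈xs) }) ,
         (λ { (inj₁ x≡b) → here x≡b ; (inj₂ Px) → there (proj₂ (xs≡P x) Px) })) ,
  cong suc l

bit : Bool → ℕ
bit true  = 1
bit false = 0

count : (ℕ → Bool) → List ℕ → ℕ
count f xs = length (filterᵇ f xs)

count-∷ : (f : ℕ → Bool) (x : ℕ) (xs : List ℕ) → count f (x ∷ xs) ≡ bit (f x) + count f xs
count-∷ f x xs with f x
... | true  = refl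
... | false = refl

∈-filterᵇ⁻ : {f : ℕ → Bool} {x : ℕ} {xs : List ℕ} → x ∈ filterᵇ f xs → x ∈ xs × f x ≡ true
∈-filterᵇ⁻ {f} x∈ with ∈-filter⁻ (T? ∘ f) x∈
... | x∈xs , Tfx = x∈xs , Equivalence.to T-≡ Tfx

∈-filterᵇ⁺ : {f : ℕ → Bool} {x : ℕ} {xs : List ℕ} → x ∈ xs → f x ≡ true → x ∈ filterᵇ f xs
∈-filterᵇ⁺ {f} x∈xs fx = ∈-filter⁺ (T? ∘ f) x∈xs (Equivalence.from T-≡ fx)

HasCard-count : {P : Pred} (f : ℕ → Bool) {E : List ℕ} → Unique E → (∀ x → P x → x ∈ E) →
  (∀ x → x ∈ E → (f x ≡ true ⇔′ P x)) → HasCard P (count f E)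
HasCard-count f {E} !E P⊆E f⇔P =
  filterᵇ f E , Unique.filter⁺ (T? ∘ f) !E ,
  (λ x → (λ x∈ → let (x∈E , fx) = ∈-filterᵇ⁻ x∈ in proj₁ (f⇔P x x∈E) fx) ,
         (λ Px → ∈-filterᵇ⁺ (P⊆E x Px) (proj₂ (f⇔P x (P⊆E x Px)) Px))) ,
  refl

count-complement : (f g : ℕ → Bool) (xs : List ℕ) → (∀ x → g x ≡ not (f x)) → count f xs + count g xs ≡ length xs
count-complement f g []       _   = refl
count-complement f g (x ∷ xs) g≡¬f rewrite count-∷ f x xs | count-∷ g x xs | g≡¬f x with f x
... | true  = cong suc (count-complement f g xs g≡¬f)
... | false = trans (+-suc (count f xs) _) (cong suc (count-complement f g xs g≡¬f))

count-all : (f : ℕ → Bool) (xs : List ℕ) → (∀ x → x ∈ xs → f x ≡ true) → count f xs ≡ length xs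
count-all f xs all-true =
  cong length (filter-all (T? ∘ f) (All.tabulate λ {x} x∈xs → Equivalence.from T-≡ (all-true x x∈xs)))

count-none : (f : ℕ → Bool) (xs : List ℕ) → (∀ x → x ∈ xs → f x ≡ false) → count f xs ≡ 0
count-none f xs all-false =
  cong length (filter-none (T? ∘ f) (All.tabulate λ {x} x∈xs Tfx → subst T (all-false x x∈xs) Tfx))

∈⇒1≤count : (f : ℕ → Bool) {x : ℕ} {xs : List ℕ} → x ∈ xs → f x ≡ true → 1 ≤ count f xs
∈⇒1≤count f x∈xs fx = filter-some (T? ∘ f) (Any.map (λ { refl → Equivalence.from T-≡ fx }) x∈xs)

1≤count⇒∈ : (f : ℕ → Bool) (xs : List ℕ) → 1 ≤ count f xs → ∃ λ x → x ∈ xs × f x ≡ true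
1≤count⇒∈ f xs 1≤ with filterᵇ f xs in eq
... | x ∷ _ = x , ∈-filterᵇ⁻ (subst (x ∈_) (sym eq) (here refl))

_─_ : List ℕ → ℕ → List ℕ
ys ─ x = filter (λ y → ¬? (y ≟ x)) ys

∈-─⁺ : {x y : ℕ} {ys : List ℕ} → y ∈ ys → y ≢ x → y ∈ ys ─ x
∈-─⁺ {x} = ∈-filter⁺ (λ y → ¬? (y ≟ x))

∈-─⁻ : {x y : ℕ} {ys : List ℕ} → y ∈ ys ─ x → y ∈ ys × y ≢ x
∈-─⁻ {x} = ∈-filter⁻ (λ y → ¬? (y ≟ x))

Unique-─ : {ys : List ℕ} (x : ℕ) → Unique ys → Unique (ys ─ x)
Unique-─ x = Unique.filter⁺ (λ y → ¬? (y ≟ x))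

count-─ : (f : ℕ → Bool) {x : ℕ} (ys : List ℕ) → Unique ys → x ∈ ys → count f ys ≡ bit (f x) + count f (ys ─ x)
count-─ f (y ∷ ys) (y∉ys ∷ _) (here refl)
  rewrite filter-reject (λ v → ¬? (v ≟ y)) {y} {ys} (λ y≢y → y≢y refl)
        | filter-all (λ v → ¬? (v ≟ y)) (All.map (λ y≢v v≡y → y≢v (sym v≡y)) y∉ys)
  = count-∷ f y ys
count-─ f {x} (y ∷ ys) (y∉ys ∷ !ys) (there x∈ys)
  rewrite filter-accept (λ v → ¬? (v ≟ x)) {y} {ys} (λ y≡x → All.lookup y∉ys x∈ys y≡x)
        | count-∷ f y ys | count-∷ f y (ys ─ x) | count-─ f ys !ys x∈ys
  = x∙yz≈y∙xz (bit (f y)) (bit (f x)) (count f (ys ─ x))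

count-cong : {f g : ℕ → Bool} → (∀ x → f x ≡ g x) → (xs : List ℕ) → count f xs ≡ count g xs
count-cong {f} {g} f≗g xs = cong length (filter-≐ (T? ∘ f) (T? ∘ g)
  ((λ {x} → subst T (f≗g x)) , (λ {x} → subst T (sym (f≗g x)))) xs)

count-partition : (f c : ℕ → Bool) (xs : List ℕ) → count f xs ≡ count f (filterᵇ (not ∘ c) xs) + count f (filterᵇ c xs)
count-partition f c []       = refl
count-partition f c (x ∷ xs) with c x
... | true  rewrite count-∷ f x xs | count-∷ f x (filterᵇ c xs) | count-partition f c xs
  = x∙yz≈y∙xz (bit (f x)) (count f (filterᵇ (not ∘ c) xs)) (count f (filterᵇ c xs))
... | false rewrite count-∷ f x xs | count-∷ f x (filterᵇ (not ∘ c) xs) | count-partition f c xs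
  = sym (+-assoc (bit (f x)) (count f (filterᵇ (not ∘ c) xs)) (count f (filterᵇ c xs)))

-- Pairings and their transversals

mem : FinSet → ℕ → Bool
mem A x = does (x ∈? A)

mem-true⁻ : {A : FinSet} {x : ℕ} → mem A x ≡ true → x ∈ A
mem-true⁻ {A} {x} e with x ∈? A
... | yes x∈A = x∈A

mem-false⁻ : {A : FinSet} {x : ℕ} → mem A x ≡ false → x ∉ A
mem-false⁻ {A} {x} e with x ∈? A
... | no x∉A = x∉A

Pairing : Set
Pairing = List (ℕ × ℕ)

pairElems : ℕ × ℕ → List ℕ
pairElems (p , q) = p ∷ q ∷ []

elems : Pairing → List ℕ
elems []            = []
elems ((p , q) ∷ P) = p ∷ q ∷ elems P

length-elems : (P : Pairing) → length (elems P) ≡ 2 * length P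
length-elems []            = refl
length-elems ((p , q) ∷ P) = cong suc (trans (cong suc (length-elems P)) (sym (+-suc (length P) (length P + 0))))

∈-elems⁻ : {x : ℕ} (P : Pairing) → x ∈ elems P → ∃ λ pr → pr ∈ P × x ∈ pairElems pr
∈-elems⁻ ((p , q) ∷ P) (here x≡p)         = (p , q) , here refl , here x≡p
∈-elems⁻ ((p , q) ∷ P) (there (here x≡q)) = (p , q) , here refl , there (here x≡q)
∈-elems⁻ ((p , q) ∷ P) (there (there x∈)) with ∈-elems⁻ P x∈
... | pr , pr∈P , x∈pr = pr , there pr∈P , x∈pr

∈-elems⁺ : {x : ℕ} {pr : ℕ × ℕ} (P : Pairing) → pr ∈ P → x ∈ pairElems pr → x ∈ elems P
∈-elems⁺ ((p , q) ∷ P) (here refl) (here x≡p)         = here x≡p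
∈-elems⁺ ((p , q) ∷ P) (here refl) (there (here x≡q)) = there (here x≡q)
∈-elems⁺ ((p , q) ∷ P) (there pr∈P) x∈pr             = there (there (∈-elems⁺ P pr∈P x∈pr))

pair-≢ : {p q : ℕ} (P : Pairing) → Unique (elems P) → (p , q) ∈ P → p ≢ q
pair-≢ (_ ∷ P) ((p∉ ∷ _) ∷ _)  (here refl)  = p∉
pair-≢ (_ ∷ P) (_ ∷ (_ ∷ !P)) (there pr∈P) = pair-≢ P !P pr∈P

pair-unique : {x : ℕ} {pr pr′ : ℕ × ℕ} (P : Pairing) → Unique (elems P) → pr ∈ P → pr′ ∈ P →
  x ∈ pairElems pr → x ∈ pairElems pr′ → pr ≡ pr′
pair-unique (_ ∷ P) _ (here refl) (here refl) _ _ = refl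
pair-unique ((p , q) ∷ P) !P (here refl) (there pr′∈P) x∈pr x∈pr′ =
  ⊥-elim (fresh-head P !P x∈pr (∈-elems⁺ P pr′∈P x∈pr′))
  where
  fresh-head : ∀ {x} P → Unique (elems ((p , q) ∷ P)) → x ∈ pairElems (p , q) → x ∉ elems P
  fresh-head P ((_ ∷ p∉) ∷ _) (here refl) x∈P = All.lookup p∉ x∈P refl
  fresh-head P (_ ∷ (q∉ ∷ _)) (there (here refl)) x∈P = All.lookup q∉ x∈P refl
pair-unique ((p , q) ∷ P) !P (there pr∈P) (here refl) x∈pr x∈pr′ =
  sym (pair-unique ((p , q) ∷ P) !P (here refl) (there pr∈P) x∈pr′ x∈pr)
pair-unique (_ ∷ P) (_ ∷ (_ ∷ !P)) (there pr∈P) (there pr′∈P) x∈pr x∈pr′ =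
  pair-unique P !P pr∈P pr′∈P x∈pr x∈pr′

OneOf : ℕ × ℕ → FinSet → Set
OneOf (a , b) B = (a ∈ B × b ∉ B) ⊎ (a ∉ B × b ∈ B)

IsTransversal : Pairing → FinSet → Set
IsTransversal P B = (∀ x → x ∈ B → x ∈ elems P) × All (λ pr → OneOf pr B) P

≐-refl : {A : FinSet} → A ≐ A
≐-refl x = (λ p → p) , (λ p → p)

≐-sym : {A B : FinSet} → A ≐ B → B ≐ A
≐-sym A≐B x = proj₂ (A≐B x) , proj₁ (A≐B x)

≐-trans : {A B C : FinSet} → A ≐ B → B ≐ C → A ≐ C
≐-trans A≐B B≐C x = (λ m → proj₁ (B≐C x) (proj₁ (A≐B x) m)) , (λ m → proj₂ (A≐B x) (proj₂ (B≐C x) m))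

OneOf-≐ : {A B : FinSet} (pr : ℕ × ℕ) → A ≐ B → OneOf pr A → OneOf pr B
OneOf-≐ (a , b) A≐B (inj₁ (a∈ , b∉)) = inj₁ (proj₁ (A≐B a) a∈ , λ b∈ → b∉ (proj₂ (A≐B b) b∈))
OneOf-≐ (a , b) A≐B (inj₂ (a∉ , b∈)) = inj₂ ((λ a∈ → a∉ (proj₂ (A≐B a) a∈)) , proj₁ (A≐B b) b∈)

IsTransversal-≐ : {P : Pairing} {A B : FinSet} → A ≐ B → IsTransversal P A → IsTransversal P B
IsTransversal-≐ A≐B (A⊆P , oneOf) = (λ x x∈B → A⊆P x (proj₂ (A≐B x) x∈B)) , All.map (OneOf-≐ _ A≐B) oneOf

pick : (ℕ × ℕ → Bool) → ℕ × ℕ → ℕ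
pick h (p , q) = if h (p , q) then p else q

choose : (ℕ × ℕ → Bool) → Pairing → List ℕ
choose h = map (pick h)

pick-∈ : (h : ℕ × ℕ → Bool) (pr : ℕ × ℕ) → pick h pr ∈ pairElems pr
pick-∈ h (p , q) with h (p , q)
... | true  = here refl
... | false = there (here refl)

pick-∈-choose : (h : ℕ × ℕ → Bool) {P : Pairing} {pr : ℕ × ℕ} → pr ∈ P → pick h pr ∈ choose h P
pick-∈-choose h = ∈-map⁺ (pick h)

choose-⊆ : (h : ℕ × ℕ → Bool) (P : Pairing) {x : ℕ} → x ∈ choose h P → x ∈ elems P
choose-⊆ h P x∈ with ∈-map⁻ (pick h) x∈
... | pr , pr∈P , refl = ∈-elems⁺ P pr∈P (pick-∈ h pr)

∈-choose⇒pick : (h : ℕ × ℕ → Bool) (P : Pairing) {x : ℕ} {pr : ℕ × ℕ} → Unique (elems P) →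
  pr ∈ P → x ∈ pairElems pr → x ∈ choose h P → x ≡ pick h pr
∈-choose⇒pick h P !P pr∈P x∈pr x∈ with ∈-map⁻ (pick h) x∈
... | pr′ , pr′∈P , refl with pair-unique P !P pr∈P pr′∈P x∈pr (pick-∈ h pr′)
... | refl = refl

choose-IsTransversal : (h : ℕ × ℕ → Bool) (P : Pairing) → Unique (elems P) → IsTransversal P (choose h P)
choose-IsTransversal h P !P = (λ x → choose-⊆ h P) , All.tabulate oneOf
  where
  oneOf : ∀ {pr} → pr ∈ P → OneOf pr (choose h P)
  oneOf {p , q} pr∈P with pick-∈ h (p , q)
  ... | here pick≡p =
    inj₁ (subst (_∈ choose h P) pick≡p (pick-∈-choose h pr∈P) ,
          λ q∈ → pair-≢ P !P pr∈P (trans (sym pick≡p) (sym (∈-choose⇒pick h P !P pr∈P (there (here refl)) q∈))))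
  ... | there (here pick≡q) =
    inj₂ ((λ p∈ → pair-≢ P !P pr∈P (trans (∈-choose⇒pick h P !P pr∈P (here refl) p∈) pick≡q)) ,
          subst (_∈ choose h P) pick≡q (pick-∈-choose h pr∈P))

sum-≡length : {ns : List ℕ} → All (_≡ 1) ns → sum ns ≡ length ns
sum-≡length []         = refl
sum-≡length (refl ∷ ns) = cong suc (sum-≡length ns)

length≤sum : {ns : List ℕ} → All (1 ≤_) ns → length ns ≤ sum ns
length≤sum []         = z≤n
length≤sum (1≤n ∷ ns) = +-mono-≤ 1≤n (length≤sum ns)

sum≡length⇒All≡1 : {ns : List ℕ} → All (1 ≤_) ns → sum ns ≡ length ns → All (_≡ 1) ns
sum≡length⇒All≡1 []                        _ = []
sum≡length⇒All≡1 {1 ∷ _} (_ ∷ ns)           e = refl ∷ sum≡length⇒All≡1 ns (suc-injective e)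
sum≡length⇒All≡1 {suc (suc n) ∷ ns} (_ ∷ 1≤ns) e = ⊥-elim (<-irrefl refl (begin-strict
  length ns      ≤⟨ length≤sum 1≤ns ⟩
  sum ns         ≤⟨ m≤n+m (sum ns) n ⟩
  n + sum ns     <⟨ n<1+n (n + sum ns) ⟩
  suc (n + sum ns) ≡⟨ suc-injective e ⟩
  length ns      ∎))
  where open ≤-Reasoning

pairCount : (ℕ → Bool) → ℕ × ℕ → ℕ
pairCount f (p , q) = bit (f p) + bit (f q)

pairCount-complementary : (f g : ℕ → Bool) {p q : ℕ} → g p ≡ not (f q) → g q ≡ not (f p) →
  pairCount f (p , q) + pairCount g (p , q) ≡ 2
pairCount-complementary f g {p} {q} gp≡ gq≡ rewrite gp≡ | gq≡ with f p | f q
... | true  | true  = refl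
... | true  | false = refl
... | false | true  = refl
... | false | false = refl

count-elems : (f : ℕ → Bool) (P : Pairing) → count f (elems P) ≡ sum (map (pairCount f) P)
count-elems f [] = refl
count-elems f ((p , q) ∷ P) = begin
  count f (p ∷ q ∷ elems P)                   ≡⟨ count-∷ f p (q ∷ elems P) ⟩
  bit (f p) + count f (q ∷ elems P)           ≡⟨ cong (bit (f p) +_) (count-∷ f q (elems P)) ⟩
  bit (f p) + (bit (f q) + count f (elems P)) ≡⟨ sym (+-assoc (bit (f p)) (bit (f q)) _) ⟩
  pairCount f (p , q) + count f (elems P)     ≡⟨ cong (pairCount f (p , q) +_) (count-elems f P) ⟩
  pairCount f (p , q) + sum (map (pairCount f) P) ∎
  where open ≡-Reasoning

OneOf⇒pairCount≡1 : {B : FinSet} (pr : ℕ × ℕ) → OneOf pr B → pairCount (mem B) pr ≡ 1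
OneOf⇒pairCount≡1 {B} (p , q) (inj₁ (p∈ , q∉)) rewrite dec-true (p ∈? B) p∈ | dec-false (q ∈? B) q∉ = refl
OneOf⇒pairCount≡1 {B} (p , q) (inj₂ (p∉ , q∈)) rewrite dec-false (p ∈? B) p∉ | dec-true (q ∈? B) q∈ = refl

pairCount≡1⇒OneOf : {B : FinSet} (pr : ℕ × ℕ) → pairCount (mem B) pr ≡ 1 → OneOf pr B
pairCount≡1⇒OneOf {B} (p , q) e with mem B p in ep | mem B q in eq
... | true  | false = inj₁ (mem-true⁻ ep , mem-false⁻ eq)
... | false | true  = inj₂ (mem-false⁻ ep , mem-true⁻ eq)

Any⇒1≤pairCount : {B : FinSet} (pr : ℕ × ℕ) → Any (_∈ B) (pairElems pr) → 1 ≤ pairCount (mem B) pr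
Any⇒1≤pairCount {B} (p , q) (here p∈) rewrite dec-true (p ∈? B) p∈ = s≤s z≤n
Any⇒1≤pairCount {B} (p , q) (there (here q∈)) rewrite dec-true (q ∈? B) q∈ = m≤n+m 1 (bit (mem B p))

HasCard-count-mem : {B : FinSet} (P : Pairing) → Unique (elems P) → (∀ x → x ∈ B → x ∈ elems P) →
  HasCard (_∈ B) (count (mem B) (elems P))
HasCard-count-mem {B} P !P B⊆P = HasCard-count (mem B) !P B⊆P (λ x _ → mem-true⁻ , dec-true (x ∈? B))

IsTransversal-card : {B : FinSet} (P : Pairing) → Unique (elems P) → IsTransversal P B → HasCard (_∈ B) (length P)
IsTransversal-card {B} P !P (B⊆P , oneOf) = subst (HasCard (_∈ B)) count≡ (HasCard-count-mem P !P B⊆P)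
  where
  count≡ : count (mem B) (elems P) ≡ length P
  count≡ = trans (count-elems (mem B) P)
           (trans (sum-≡length (All.map⁺ (All.map (OneOf⇒pairCount≡1 _) oneOf))) (length-map (pairCount (mem B)) P))

Hits : Pairing → FinSet → Set
Hits P B = All (λ pr → Any (_∈ B) (pairElems pr)) P

IsHittingSet : Pairing → FinSet → Set
IsHittingSet P B = (∀ x → x ∈ B → x ∈ elems P) × HasCard (_∈ B) (length P) × Hits P B

IsTransversal⇒IsHittingSet : {B : FinSet} (P : Pairing) → Unique (elems P) → IsTransversal P B → IsHittingSet P B
IsTransversal⇒IsHittingSet P !P T@(B⊆P , oneOf) = B⊆P , IsTransversal-card P !P T , All.map hit oneOf
  where
  hit : ∀ {B pr} → OneOf pr B → Any (_∈ B) (pairElems pr)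
  hit (inj₁ (p∈ , _)) = here p∈
  hit (inj₂ (_ , q∈)) = there (here q∈)

-- Every pair contributes at least one element of B, and the contributions add up to |B| = |P|.
IsHittingSet⇒IsTransversal : {B : FinSet} (P : Pairing) → Unique (elems P) → IsHittingSet P B → IsTransversal P B
IsHittingSet⇒IsTransversal {B} P !P (B⊆P , card , hits) =
  B⊆P , All.map (pairCount≡1⇒OneOf _) (All.map⁻ (sum≡length⇒All≡1 (All.map⁺ (All.map (Any⇒1≤pairCount _) hits)) sum≡))
  where
  sum≡ : sum (map (pairCount (mem B)) P) ≡ length (map (pairCount (mem B)) P)
  sum≡ = trans (sym (count-elems (mem B) P))
         (trans (HasCard-unique (HasCard-count-mem P !P B⊆P) card) (sym (length-map (pairCount (mem B)) P)))

-- The hke identity for transversals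

UnionIntersectionSum : Collection → ℕ → Set
UnionIntersectionSum Γ n = Σ ℕ λ u → Σ ℕ λ i → HasCard (⋃ Γ) u × HasCard (⋂ Γ) i × (u + i ≡ n)

⋃ᵇ : Collection → ℕ → Bool
⋃ᵇ []      x = false
⋃ᵇ (A ∷ Γ) x = mem A x ∨ ⋃ᵇ Γ x

⋂ᵇ : Collection → ℕ → Bool
⋂ᵇ []      x = true
⋂ᵇ (A ∷ Γ) x = mem A x ∧ ⋂ᵇ Γ x

⋃ᵇ-sound : (Γ : Collection) (x : ℕ) → ⋃ᵇ Γ x ≡ true → ⋃ Γ x
⋃ᵇ-sound (A ∷ Γ) x e with mem A x in x∈A
... | true  = here (mem-true⁻ x∈A)
... | false = there (⋃ᵇ-sound Γ x e)

⋃ᵇ-complete : (Γ : Collection) (x : ℕ) → ⋃ Γ x → ⋃ᵇ Γ x ≡ true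
⋃ᵇ-complete (A ∷ Γ) x (here x∈A) rewrite dec-true (x ∈? A) x∈A = refl
⋃ᵇ-complete (A ∷ Γ) x (there x∈Γ) rewrite ⋃ᵇ-complete Γ x x∈Γ with mem A x
... | true  = refl
... | false = refl

⋂ᵇ-sound : (Γ : Collection) (x : ℕ) → ⋂ᵇ Γ x ≡ true → ⋂ Γ x
⋂ᵇ-sound []      x e = []
⋂ᵇ-sound (A ∷ Γ) x e with mem A x in x∈A
... | true = mem-true⁻ x∈A ∷ ⋂ᵇ-sound Γ x e

⋂ᵇ-complete : (Γ : Collection) (x : ℕ) → ⋂ Γ x → ⋂ᵇ Γ x ≡ true
⋂ᵇ-complete []      x []           = refl
⋂ᵇ-complete (A ∷ Γ) x (x∈A ∷ x∈Γ) rewrite dec-true (x ∈? A) x∈A = ⋂ᵇ-complete Γ x x∈Γ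

⋃ᵇ⇔⋃ : (Γ : Collection) (x : ℕ) → ⋃ᵇ Γ x ≡ true ⇔′ ⋃ Γ x
⋃ᵇ⇔⋃ Γ x = ⋃ᵇ-sound Γ x , ⋃ᵇ-complete Γ x

⋂ᵇ⇔⋂ : (Γ : Collection) (x : ℕ) → ⋂ᵇ Γ x ≡ true ⇔′ ⋂ Γ x
⋂ᵇ⇔⋂ Γ x = ⋂ᵇ-sound Γ x , ⋂ᵇ-complete Γ x

OneOf-swap : {p q : ℕ} {A : FinSet} → OneOf (p , q) A → OneOf (q , p) A
OneOf-swap (inj₁ (p∈ , q∉)) = inj₂ (q∉ , p∈)
OneOf-swap (inj₂ (p∉ , q∈)) = inj₁ (q∈ , p∉)

⋂ᵇ≡not⋃ᵇ : {p q : ℕ} (Γ : Collection) → All (OneOf (p , q)) Γ → ⋂ᵇ Γ p ≡ not (⋃ᵇ Γ q)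
⋂ᵇ≡not⋃ᵇ []      [] = refl
⋂ᵇ≡not⋃ᵇ {p} {q} (A ∷ Γ) (oneOf ∷ oneOfs) rewrite ⋂ᵇ≡not⋃ᵇ Γ oneOfs with oneOf
... | inj₁ (p∈ , q∉) rewrite dec-true (p ∈? A) p∈ | dec-false (q ∈? A) q∉ = refl
... | inj₂ (p∉ , q∈) rewrite dec-false (p ∈? A) p∉ | dec-true (q ∈? A) q∈ = refl

pairCount-⋃ᵇ+⋂ᵇ : (Γ : Collection) (pr : ℕ × ℕ) → All (OneOf pr) Γ →
  pairCount (⋃ᵇ Γ) pr + pairCount (⋂ᵇ Γ) pr ≡ 2
pairCount-⋃ᵇ+⋂ᵇ Γ (p , q) oneOfs =
  pairCount-complementary (⋃ᵇ Γ) (⋂ᵇ Γ) (⋂ᵇ≡not⋃ᵇ Γ oneOfs) (⋂ᵇ≡not⋃ᵇ Γ (All.map OneOf-swap oneOfs))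

sum-map+sum-map≡2*length : {A : Set} (f g : A → ℕ) (xs : List A) → All (λ x → f x + g x ≡ 2) xs →
  sum (map f xs) + sum (map g xs) ≡ 2 * length xs
sum-map+sum-map≡2*length f g []       []       = refl
sum-map+sum-map≡2*length f g (x ∷ xs) (e ∷ es) = begin
  (f x + sum (map f xs)) + (g x + sum (map g xs)) ≡⟨ interchange (f x) _ (g x) _ ⟩
  (f x + g x) + (sum (map f xs) + sum (map g xs)) ≡⟨ cong₂ _+_ e (sum-map+sum-map≡2*length f g xs es) ⟩
  2 + 2 * length xs                               ≡⟨ sym (*-suc 2 (length xs)) ⟩
  2 * suc (length xs)                             ∎
  where open ≡-Reasoning

transversals-UnionIntersectionSum : (P : Pairing) → Unique (elems P) → (Γ : Collection) → Γ ≢ [] →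
  All (IsTransversal P) Γ → UnionIntersectionSum Γ (2 * length P)
transversals-UnionIntersectionSum P !P []      Γ≢[] _  = ⊥-elim (Γ≢[] refl)
transversals-UnionIntersectionSum P !P (A ∷ Γ) _    Ts =
  count (⋃ᵇ (A ∷ Γ)) (elems P) , count (⋂ᵇ (A ∷ Γ)) (elems P) ,
  HasCard-count (⋃ᵇ (A ∷ Γ)) !P ⋃⊆P (λ x _ → ⋃ᵇ⇔⋃ (A ∷ Γ) x) ,
  HasCard-count (⋂ᵇ (A ∷ Γ)) !P (λ { x (x∈A ∷ _) → proj₁ (All.head Ts) x x∈A }) (λ x _ → ⋂ᵇ⇔⋂ (A ∷ Γ) x) ,
  trans (cong₂ _+_ (count-elems (⋃ᵇ (A ∷ Γ)) P) (count-elems (⋂ᵇ (A ∷ Γ)) P))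
        (sum-map+sum-map≡2*length _ _ P (All.tabulate λ pr∈P →
          pairCount-⋃ᵇ+⋂ᵇ (A ∷ Γ) _ (All.map (λ T → All.lookup (proj₂ T) pr∈P) Ts)))
  where
  ⋃⊆P : ∀ x → ⋃ (A ∷ Γ) x → x ∈ elems P
  ⋃⊆P x x∈⋃ with find x∈⋃
  ... | B , B∈Γ , x∈B = proj₁ (All.lookup Ts B∈Γ) x x∈B

-- Maximality of transversal families

∈-choose⁺ : (h : ℕ × ℕ → Bool) (P : Pairing) {x : ℕ} {pr : ℕ × ℕ} → pr ∈ P → x ≡ pick h pr → x ∈ choose h P
∈-choose⁺ h P pr∈P refl = pick-∈-choose h pr∈P

choose-cover : (P : Pairing) {x : ℕ} → x ∈ elems P → x ∈ choose (λ _ → true) P ⊎ x ∈ choose (λ _ → false) P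
choose-cover P x∈P with ∈-elems⁻ P x∈P
... | (p , q) , pr∈P , here x≡p         = inj₁ (∈-choose⁺ _ P pr∈P x≡p)
... | (p , q) , pr∈P , there (here x≡q) = inj₂ (∈-choose⁺ _ P pr∈P x≡q)

firstUnless : ℕ → ℕ × ℕ → Bool
firstUnless b (p , q) = not (does (p ≟ b))

secondUnless : ℕ → ℕ × ℕ → Bool
secondUnless b (p , q) = does (q ≟ b)

pick-firstUnless : {b p q : ℕ} → p ≢ b → pick (firstUnless b) (p , q) ≡ p
pick-firstUnless {b} {p} p≢b rewrite dec-false (p ≟ b) p≢b = refl

pick-firstUnless-self : {b q : ℕ} → pick (firstUnless b) (b , q) ≡ q
pick-firstUnless-self {b} rewrite dec-true (b ≟ b) refl = refl

pick-secondUnless : {b p q : ℕ} → q ≢ b → pick (secondUnless b) (p , q) ≡ q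
pick-secondUnless {b} {p} {q} q≢b rewrite dec-false (q ≟ b) q≢b = refl

pick-secondUnless-self : {b p : ℕ} → pick (secondUnless b) (p , b) ≡ p
pick-secondUnless-self {b} rewrite dec-true (b ≟ b) refl = refl

avoiding : ℕ → Pairing → FinSet
avoiding b = choose (firstUnless b)

through : ℕ → Pairing → FinSet
through x = choose (λ (p , _) → does (p ≟ x))

pick-through : {x : ℕ} (pr : ℕ × ℕ) → x ∈ pairElems pr → pick (λ (p , _) → does (p ≟ x)) pr ≡ x
pick-through (p , q) (here refl) rewrite dec-true (p ≟ p) refl = refl
pick-through (p , q) (there (here refl)) with p ≟ q
... | yes p≡q rewrite dec-true (p ≟ q) p≡q = p≡q
... | no  p≢q rewrite dec-false (p ≟ q) p≢q = refl

∈-through : {x : ℕ} (P : Pairing) → x ∈ elems P → x ∈ through x P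
∈-through P x∈P with ∈-elems⁻ P x∈P
... | pr , pr∈P , x∈pr = ∈-choose⁺ _ P pr∈P (sym (pick-through pr x∈pr))

module Splitting (P : Pairing) (!P : Unique (elems P)) {a b : ℕ} (ab∈P : (a , b) ∈ P) where

  T₁ : FinSet
  T₁ = avoiding b P

  T₂ : FinSet
  T₂ = choose (secondUnless b) P

  a≢b : a ≢ b
  a≢b = pair-≢ P !P ab∈P

  b-pair : {p q : ℕ} → (p , q) ∈ P → b ∈ pairElems (p , q) → (p , q) ≡ (a , b)
  b-pair pq∈P b∈pq = pair-unique P !P pq∈P ab∈P b∈pq (there (here refl))

  a∈T₁ : a ∈ T₁
  a∈T₁ = ∈-choose⁺ (firstUnless b) P ab∈P (sym (pick-firstUnless a≢b))

  a∈T₂ : a ∈ T₂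
  a∈T₂ = ∈-choose⁺ (secondUnless b) P ab∈P (sym (pick-secondUnless-self {b}))

  b∉T₁ : b ∉ T₁
  b∉T₁ b∈ = a≢b (trans (sym (pick-firstUnless a≢b))
                       (sym (∈-choose⇒pick (firstUnless b) P !P ab∈P (there (here refl)) b∈)))

  b∉T₂ : b ∉ T₂
  b∉T₂ b∈ = a≢b (trans (sym (pick-secondUnless-self {b}))
                       (sym (∈-choose⇒pick (secondUnless b) P !P ab∈P (there (here refl)) b∈)))

  picks-agree⇒a : {p q : ℕ} → (p , q) ∈ P → pick (firstUnless b) (p , q) ≡ pick (secondUnless b) (p , q) →
    pick (firstUnless b) (p , q) ≡ a
  picks-agree⇒a {p} {q} pq∈P agree with q ≟ b | p ≟ b
  ... | yes refl | _ with b-pair pq∈P (there (here refl))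
  ...   | refl = pick-firstUnless a≢b
  picks-agree⇒a pq∈P agree | no q≢b | yes refl with b-pair pq∈P (here refl)
  ...   | refl = ⊥-elim (q≢b refl)
  picks-agree⇒a pq∈P agree | no q≢b | no p≢b =
    ⊥-elim (pair-≢ P !P pq∈P (trans (sym (pick-firstUnless p≢b)) (trans agree (pick-secondUnless q≢b))))

  T₁∩T₂≡a : {x : ℕ} → x ∈ T₁ → x ∈ T₂ → x ≡ a
  T₁∩T₂≡a x∈T₁ x∈T₂ with ∈-map⁻ (pick (firstUnless b)) x∈T₁
  ... | pr , pr∈P , refl = picks-agree⇒a pr∈P (∈-choose⇒pick (secondUnless b) P !P pr∈P (pick-∈ (firstUnless b) pr) x∈T₂)

  T₁∪T₂⊇E∖b : {x : ℕ} → x ∈ elems P → x ≢ b → x ∈ T₁ ⊎ x ∈ T₂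
  T₁∪T₂⊇E∖b x∈P x≢b with ∈-elems⁻ P x∈P
  ... | (p , q) , pq∈P , here refl         = inj₁ (∈-choose⁺ (firstUnless b) P pq∈P (sym (pick-firstUnless x≢b)))
  ... | (p , q) , pq∈P , there (here refl) = inj₂ (∈-choose⁺ (secondUnless b) P pq∈P (sym (pick-secondUnless x≢b)))

-- If A were not a transversal, two suitable transversals T, T′ would make |⋃ {A, T, T′}| + |⋂ {A, T, T′}| ≠ 2 |P|.
module _ (P : Pairing) (!P : Unique (elems P)) (A : FinSet)
  (hke : ∀ T T′ → IsTransversal P T → IsTransversal P T′ → UnionIntersectionSum (A ∷ T ∷ T′ ∷ []) (2 * length P))
  where

  private
    n = length P

    |elems| : HasCard (_∈ elems P) (2 * n)
    |elems| = subst (HasCard _) (length-elems P) (HasCard-list !P)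

  A⊆elems : (z : ℕ) → z ∈ A → z ∈ elems P
  A⊆elems z z∈A with z ∈? elems P
  ... | yes z∈E = z∈E
  ... | no  z∉E with hke _ _ (choose-IsTransversal (λ _ → true) P !P) (choose-IsTransversal (λ _ → false) P !P)
  ... | u , i , |⋃| , _ , u+i≡2n = ⊥-elim (<-irrefl refl (begin-strict
    2 * n     <⟨ HasCard-mono ⊆⋃ (HasCard-insert z z∉E |elems|) |⋃| ⟩
    u         ≤⟨ m≤m+n u i ⟩
    u + i     ≡⟨ u+i≡2n ⟩
    2 * n     ∎))
    where
    open ≤-Reasoning
    ⊆⋃ : ∀ x → x ≡ z ⊎ x ∈ elems P → ⋃ (A ∷ _ ∷ _ ∷ []) x
    ⊆⋃ x (inj₁ refl) = here z∈A
    ⊆⋃ x (inj₂ x∈E) with choose-cover P x∈E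
    ... | inj₁ x∈T = there (here x∈T)
    ... | inj₂ x∈T′ = there (there (here x∈T′))

  module _ {a b : ℕ} (ab∈P : (a , b) ∈ P) where
    open Splitting P !P ab∈P

    private
      Γ : Collection
      Γ = A ∷ T₁ ∷ T₂ ∷ []

    a∈A⇒b∉A : a ∈ A → b ∉ A
    a∈A⇒b∉A a∈A b∈A with hke T₁ T₂ (choose-IsTransversal _ P !P) (choose-IsTransversal _ P !P)
    ... | u , i , |⋃| , |⋂| , u+i≡2n = <-irrefl refl (begin-strict
      2 * n       <⟨ n<1+n (2 * n) ⟩
      suc (2 * n) ≡⟨ +-comm 1 (2 * n) ⟩
      2 * n + 1   ≤⟨ +-mono-≤ (HasCard-mono E⊆⋃ |elems| |⋃|) (HasCard-mono a∈⋂ (HasCard-singleton a) |⋂|) ⟩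
      u + i       ≡⟨ u+i≡2n ⟩
      2 * n       ∎)
      where
      open ≤-Reasoning
      a∈⋂ : ∀ x → x ≡ a → ⋂ Γ x
      a∈⋂ x refl = a∈A ∷ a∈T₁ ∷ a∈T₂ ∷ []
      E⊆⋃ : ∀ x → x ∈ elems P → ⋃ Γ x
      E⊆⋃ x x∈E with x ≟ b
      ... | yes refl = here b∈A
      ... | no x≢b with T₁∪T₂⊇E∖b x∈E x≢b
      ... | inj₁ x∈T₁ = there (here x∈T₁)
      ... | inj₂ x∈T₂ = there (there (here x∈T₂))

    a∉A⇒¬b∉A : a ∉ A → ¬ b ∉ A
    a∉A⇒¬b∉A a∉A b∉A with hke T₁ T₂ (choose-IsTransversal _ P !P) (choose-IsTransversal _ P !P)
    ... | u , i , |⋃| , |⋂| , u+i≡2n = <-irrefl refl (begin-strict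
      u         <⟨ HasCard-mono b∪⋃⊆E (HasCard-insert b b∉⋃ |⋃|) |elems| ⟩
      2 * n     ≡⟨ sym u+i≡2n ⟩
      u + i     ≡⟨ cong (u +_) (HasCard-unique |⋂| (HasCard-empty ⋂-empty)) ⟩
      u + 0     ≡⟨ +-identityʳ u ⟩
      u         ∎)
      where
      open ≤-Reasoning
      b∉⋃ : ¬ ⋃ Γ b
      b∉⋃ (here b∈A)                 = b∉A b∈A
      b∉⋃ (there (here b∈T₁))        = b∉T₁ b∈T₁
      b∉⋃ (there (there (here b∈T₂))) = b∉T₂ b∈T₂
      b∪⋃⊆E : ∀ x → x ≡ b ⊎ ⋃ Γ x → x ∈ elems P
      b∪⋃⊆E x (inj₁ refl)                      = ∈-elems⁺ P ab∈P (there (here refl))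
      b∪⋃⊆E x (inj₂ (here x∈A))                = A⊆elems x x∈A
      b∪⋃⊆E x (inj₂ (there (here x∈T₁)))       = choose-⊆ _ P x∈T₁
      b∪⋃⊆E x (inj₂ (there (there (here x∈T₂)))) = choose-⊆ _ P x∈T₂
      ⋂-empty : ∀ x → ¬ ⋂ Γ x
      ⋂-empty x (x∈A ∷ x∈T₁ ∷ x∈T₂ ∷ []) = a∉A (subst (_∈ A) (T₁∩T₂≡a x∈T₁ x∈T₂) x∈A)

  IsTransversal-of-hke : IsTransversal P A
  IsTransversal-of-hke = A⊆elems , All.tabulate oneOf
    where
    oneOf : ∀ {pr} → pr ∈ P → OneOf pr A
    oneOf {a , b} ab∈P with a ∈? A | b ∈? A
    ... | yes a∈A | no  b∉A = inj₁ (a∈A , b∉A)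
    ... | no  a∉A | yes b∈A = inj₂ (a∉A , b∈A)
    ... | yes a∈A | yes b∈A = ⊥-elim (a∈A⇒b∉A ab∈P a∈A b∈A)
    ... | no  a∉A | no  b∉A = ⊥-elim (a∉A⇒¬b∉A ab∈P a∉A b∉A)

UnionIntersectionSum-unique : {Γ : Collection} {m n : ℕ} →
  UnionIntersectionSum Γ m → UnionIntersectionSum Γ n → m ≡ n
UnionIntersectionSum-unique (_ , _ , |⋃| , |⋂| , refl) (_ , _ , |⋃|′ , |⋂|′ , refl) =
  cong₂ _+_ (HasCard-unique |⋃| |⋃|′) (HasCard-unique |⋂| |⋂|′)

UnionIntersectionSum-singleton : {T : FinSet} {k : ℕ} → HasCard (_∈ T) k → UnionIntersectionSum (T ∷ []) (2 * k)
UnionIntersectionSum-singleton {k = k} |T| =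
  k , k ,
  HasCard-cong (λ x → here , λ { (here x∈T) → x∈T ; (there ()) }) |T| ,
  HasCard-cong (λ x → (_∷ []) , All.head) |T| ,
  cong (k +_) (sym (+-identityʳ k))

All-∈ᶜ⇒⊆ᶜ : {Γ F : Collection} → All (_∈ᶜ F) Γ → Γ ⊆ᶜ F
All-∈ᶜ⇒⊆ᶜ Γ⊆F B B∈Γ with find B∈Γ
... | C , C∈Γ , B≐C = Any.map (≐-trans B≐C) (All.lookup Γ⊆F C∈Γ)

transversalFamily-maximal : (F : Collection) (P : Pairing) → Unique (elems P) →
  (∀ B → B ∈ᶜ F ⇔′ IsTransversal P B) → (F′ : Collection) → Hke F′ → ¬ (F ⊊ᶜ F′)
transversalFamily-maximal F P !P F≡T F′ (α′ , _ , hke) (F⊆F′ , A , A∈F′ , A∉F) =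
  A∉F (proj₂ (F≡T A) (IsTransversal-of-hke P !P A hke-triple))
  where
  ∈F′ : ∀ {T} → IsTransversal P T → T ∈ᶜ F′
  ∈F′ {T} t = F⊆F′ T (proj₂ (F≡T T) t)
  t₀ : IsTransversal P (choose (λ _ → true) P)
  t₀ = choose-IsTransversal (λ _ → true) P !P
  2α′≡2n : 2 * α′ ≡ 2 * length P
  2α′≡2n = UnionIntersectionSum-unique (hke _ (λ ()) (All-∈ᶜ⇒⊆ᶜ (∈F′ t₀ ∷ [])))
                                       (UnionIntersectionSum-singleton (IsTransversal-card P !P t₀))
  hke-triple : ∀ T T′ → IsTransversal P T → IsTransversal P T′ → UnionIntersectionSum (A ∷ T ∷ T′ ∷ []) (2 * length P)
  hke-triple T T′ t t′ =
    subst (UnionIntersectionSum _) 2α′≡2n (hke _ (λ ()) (All-∈ᶜ⇒⊆ᶜ (A∈F′ ∷ ∈F′ t ∷ ∈F′ t′ ∷ [])))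

-- Signatures and subcollections selected by masks

meets : List Bool → List Bool → Bool
meets (w ∷ W) (v ∷ V) = (w ∧ v) ∨ meets W V
meets _       _       = false

_⊆ᵇ_ : List Bool → List Bool → Bool
(w ∷ W) ⊆ᵇ (v ∷ V) = (not w ∨ v) ∧ (W ⊆ᵇ V)
_       ⊆ᵇ _       = true

weight : List Bool → ℕ
weight []      = 0
weight (b ∷ V) = bit b + weight V

⊆ᵇ-refl : (V : List Bool) → V ⊆ᵇ V ≡ true
⊆ᵇ-refl []          = refl
⊆ᵇ-refl (true ∷ V)  = ⊆ᵇ-refl V
⊆ᵇ-refl (false ∷ V) = ⊆ᵇ-refl V

⊆ᵇ-map-not : (W V : List Bool) → W ⊆ᵇ map not V ≡ not (meets W V)
⊆ᵇ-map-not []      V       = refl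
⊆ᵇ-map-not (w ∷ W) []      = refl
⊆ᵇ-map-not (w ∷ W) (v ∷ V) rewrite ⊆ᵇ-map-not W V with w | v
... | true  | true  = refl
... | true  | false = refl
... | false | _     = refl

⊆ᵇ⇒weight≤ : (W V : List Bool) → length W ≡ length V → W ⊆ᵇ V ≡ true → weight W ≤ weight V
⊆ᵇ⇒weight≤ []      []      _ _ = z≤n
⊆ᵇ⇒weight≤ (w ∷ W) (v ∷ V) l e with w | v
... | true  | true  = s≤s (⊆ᵇ⇒weight≤ W V (suc-injective l) e)
... | false | true  = m≤n⇒m≤1+n (⊆ᵇ⇒weight≤ W V (suc-injective l) e)
... | false | false = ⊆ᵇ⇒weight≤ W V (suc-injective l) e

⊆ᵇ-weight-antisym : (W V : List Bool) → length W ≡ length V → W ⊆ᵇ V ≡ true → weight V ≤ weight W → W ≡ V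
⊆ᵇ-weight-antisym []      []      _ _ _ = refl
⊆ᵇ-weight-antisym (w ∷ W) (v ∷ V) l e ≤w with w | v
... | true  | true  = cong (true ∷_) (⊆ᵇ-weight-antisym W V (suc-injective l) e (≤-pred ≤w))
... | false | false = cong (false ∷_) (⊆ᵇ-weight-antisym W V (suc-injective l) e ≤w)
... | false | true  = ⊥-elim (<-irrefl refl (≤-trans ≤w (⊆ᵇ⇒weight≤ W V (suc-injective l) e)))

select : List Bool → Collection → Collection
select []          _       = []
select (_ ∷ _)     []      = []
select (true  ∷ W) (A ∷ F) = A ∷ select W F
select (false ∷ W) (A ∷ F) = select W F

⋃ᵇ-select : (W : List Bool) (F : Collection) (x : ℕ) → ⋃ᵇ (select W F) x ≡ meets W (map (λ A → mem A x) F)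
⋃ᵇ-select []          F       x = refl
⋃ᵇ-select (w ∷ W)     []      x = refl
⋃ᵇ-select (true ∷ W)  (A ∷ F) x = cong (mem A x ∨_) (⋃ᵇ-select W F x)
⋃ᵇ-select (false ∷ W) (A ∷ F) x = ⋃ᵇ-select W F x

⋂ᵇ-select : (W : List Bool) (F : Collection) (x : ℕ) → ⋂ᵇ (select W F) x ≡ W ⊆ᵇ map (λ A → mem A x) F
⋂ᵇ-select []          F       x = refl
⋂ᵇ-select (w ∷ W)     []      x = refl
⋂ᵇ-select (true ∷ W)  (A ∷ F) x = cong (mem A x ∧_) (⋂ᵇ-select W F x)
⋂ᵇ-select (false ∷ W) (A ∷ F) x = ⋂ᵇ-select W F x

select-⊆ : (W : List Bool) (F : Collection) {C : FinSet} → C ∈ select W F → C ∈ F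
select-⊆ (true  ∷ W) (A ∷ F) (here C≡A)  = here C≡A
select-⊆ (true  ∷ W) (A ∷ F) (there C∈) = there (select-⊆ W F C∈)
select-⊆ (false ∷ W) (A ∷ F) C∈         = there (select-⊆ W F C∈)

∈-select : (g : FinSet → Bool) {F : Collection} {A : FinSet} → A ∈ F → g A ≡ true → A ∈ select (map g F) F
∈-select g {B ∷ F} (here refl) gA rewrite gA = here refl
∈-select g {B ∷ F} (there A∈F) gA with g B
... | true  = there (∈-select g A∈F gA)
... | false = ∈-select g A∈F gA

select-all : (F : Collection) → select (map (λ _ → true) F) F ≡ F
select-all []      = refl
select-all (A ∷ F) = cong (A ∷_) (select-all F)

map-≡⇒≡ : {A B : Set} {g h : A → B} (xs : List A) {x : A} → map g xs ≡ map h xs → x ∈ xs → g x ≡ h x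
map-≡⇒≡ (y ∷ xs) e (here refl) = ∷-injectiveˡ e
map-≡⇒≡ (y ∷ xs) e (there x∈) = map-≡⇒≡ xs (∷-injectiveʳ e) x∈

map-not-involutive : (V : List Bool) → map not (map not V) ≡ V
map-not-involutive V = trans (sym (map-∘ V)) (trans (map-cong not-involutive V) (map-id V))

-- σ x records which members of F contain x; the elements outside ⋂ F get paired so that partners have
-- complementary signatures, i.e. every member of F contains exactly one of them.
module ComplementPairing (A₀ : FinSet) (F₀ : Collection) where

  private
    F : Collection
    F = A₀ ∷ F₀

  σ : ℕ → List Bool
  σ x = map (λ A → mem A x) F

  σ̄ : ℕ → List Bool
  σ̄ x = map not (σ x)

  σ≢σ̄ : (x : ℕ) → σ x ≢ σ̄ x
  σ≢σ̄ x e = not-¬ refl (∷-injectiveˡ e)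

  σ≡σ̄-sym : {z y : ℕ} → σ z ≡ σ̄ y → σ y ≡ σ̄ z
  σ≡σ̄-sym {z} {y} e = trans (sym (map-not-involutive (σ y))) (cong (map not) (sym e))

  σ≡σ̄⇒OneOf : {z y : ℕ} → σ z ≡ σ̄ y → All (OneOf (z , y)) F
  σ≡σ̄⇒OneOf {z} {y} e = All.tabulate λ A∈F → oneOf (at A∈F)
    where
    at : ∀ {A} → A ∈ F → mem A z ≡ not (mem A y)
    at A∈F = map-≡⇒≡ F (trans e (sym (map-∘ F))) A∈F
    oneOf : ∀ {A} → mem A z ≡ not (mem A y) → OneOf (z , y) A
    oneOf {A} e with mem A y in y∈
    ... | true  = inj₂ (mem-false⁻ e , mem-true⁻ y∈)
    ... | false = inj₁ (mem-true⁻ e , mem-false⁻ y∈)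

  []-∌ : {C : FinSet} {G : Collection} → G ≡ [] → C ∉ G
  []-∌ refl ()

  Separated : List ℕ → Set
  Separated Y = Unique Y × All (λ y → ⋃ F y × Any (y ∉_) F) Y

  HkeOn : List ℕ → ℕ → Set
  HkeOn Y k = ∀ W → select W F ≢ [] → count (λ x → meets W (σ x)) Y + count (λ x → W ⊆ᵇ σ x) Y ≡ 2 * k

  full : List Bool
  full = map (λ _ → true) F

  meets-full : {y : ℕ} → ⋃ F y → meets full (σ y) ≡ true
  meets-full {y} y∈⋃ =
    trans (sym (⋃ᵇ-select full F y)) (trans (cong (λ Γ → ⋃ᵇ Γ y) (select-all F)) (⋃ᵇ-complete F y y∈⋃))

  full-⊆ᵇ : {y : ℕ} → Any (y ∉_) F → full ⊆ᵇ σ y ≡ false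
  full-⊆ᵇ {y} y∉A with full ⊆ᵇ σ y in e
  ... | false = refl
  ... | true  = ⊥-elim (Any-¬All y∉A (⋂ᵇ-sound F y
                  (trans (cong (λ Γ → ⋂ᵇ Γ y) (sym (select-all F))) (trans (⋂ᵇ-select full F y) e))))
    where
    Any-¬All : ∀ {G : Collection} → Any (y ∉_) G → ¬ ⋂ G y
    Any-¬All (here y∉A)  (y∈A ∷ _)  = y∉A y∈A
    Any-¬All (there y∉G) (_ ∷ y∈G) = Any-¬All y∉G y∈G

  length-Separated : {Y : List ℕ} {k : ℕ} → Separated Y → HkeOn Y k → length Y ≡ 2 * k
  length-Separated {Y} {k} (_ , sep) hke = begin
    length Y                                                        ≡⟨ sym (+-identityʳ (length Y)) ⟩
    length Y + 0                                                    ≡⟨ cong₂ _+_ (sym all-meet) (sym none-within) ⟩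
    count (λ x → meets full (σ x)) Y + count (λ x → full ⊆ᵇ σ x) Y  ≡⟨ hke full (subst (_≢ []) (sym (select-all F)) λ ()) ⟩
    2 * k                                                           ∎
    where
    open ≡-Reasoning
    all-meet : count (λ x → meets full (σ x)) Y ≡ length Y
    all-meet = count-all _ Y (λ y y∈Y → meets-full (proj₁ (All.lookup sep y∈Y)))
    none-within : count (λ x → full ⊆ᵇ σ x) Y ≡ 0
    none-within = count-none _ Y (λ y y∈Y → full-⊆ᵇ (proj₂ (All.lookup sep y∈Y)))

  IsSignature : List ℕ → List Bool → Set
  IsSignature Y V = Any (λ y → V ≡ σ y ⊎ V ≡ σ̄ y) Y

  signatures : List ℕ → List (List Bool)
  signatures Y = map σ Y ++ map σ̄ Y

  maximal-signature : (y₀ : ℕ) (Y₀ : List ℕ) → Σ (List Bool) λ W →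
    IsSignature (y₀ ∷ Y₀) W × (∀ {V} → V ∈ signatures (y₀ ∷ Y₀) → weight V ≤ weight W)
  maximal-signature y₀ Y₀ =
    argmax weight (σ y₀) (signatures Y) ,
    argmax-all weight {P = IsSignature Y} (here (inj₁ refl))
      (All.++⁺ (All.map⁺ (All.tabulate λ y∈Y → lose y∈Y (inj₁ refl)))
               (All.map⁺ (All.tabulate λ y∈Y → lose y∈Y (inj₂ refl)))) ,
    All.lookup (f[xs]≤f[argmax] {f = weight} (σ y₀) (signatures Y))
    where
    Y = y₀ ∷ Y₀

  module MaximalSignature {Y : List ℕ} {k : ℕ} (sep : Separated Y) (hke : HkeOn Y k)
    (W : List Bool) (W-IsSignature : IsSignature Y W) (weight≤W : ∀ {V} → V ∈ signatures Y → weight V ≤ weight W)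
    where

    length-W : length W ≡ length F
    length-W with find W-IsSignature
    ... | y , _ , inj₁ W≡σy = trans (cong length W≡σy) (length-map _ F)
    ... | y , _ , inj₂ W≡σ̄y = trans (cong length W≡σ̄y) (trans (length-map not (σ y)) (length-map _ F))

    ⊆σ⇒≡ : {y : ℕ} → y ∈ Y → W ⊆ᵇ σ y ≡ true → W ≡ σ y
    ⊆σ⇒≡ y∈Y W⊆ = ⊆ᵇ-weight-antisym W _ (trans length-W (sym (length-map _ F))) W⊆
                    (weight≤W (∈-++⁺ˡ (∈-map⁺ σ y∈Y)))

    ⊆σ̄⇒≡ : {y : ℕ} → y ∈ Y → W ⊆ᵇ σ̄ y ≡ true → W ≡ σ̄ y
    ⊆σ̄⇒≡ {y} y∈Y W⊆ = ⊆ᵇ-weight-antisym W _ (trans length-W (sym (trans (length-map not (σ y)) (length-map _ F)))) W⊆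
                         (weight≤W (∈-++⁺ʳ (map σ Y) (∈-map⁺ σ̄ y∈Y)))

    select-W≢[] : select W F ≢ []
    select-W≢[] with find W-IsSignature
    ... | y , y∈Y , inj₁ W≡σy with find (proj₁ (All.lookup (proj₂ sep) y∈Y))
    ...   | A , A∈F , y∈A = λ e → []-∌ e (subst (λ V → A ∈ select V F) (sym W≡σy)
                                        (∈-select (λ A → mem A y) A∈F (dec-true (y ∈? A) y∈A)))
    select-W≢[] | y , y∈Y , inj₂ W≡σ̄y with find (proj₂ (All.lookup (proj₂ sep) y∈Y))
    ...   | A , A∈F , y∉A = λ e → []-∌ e (subst (λ V → A ∈ select V F) (trans (map-∘ F) (sym W≡σ̄y))
                                        (∈-select (λ A → not (mem A y)) A∈F (cong not (dec-false (y ∈? A) y∉A))))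

    balance : count (λ x → W ⊆ᵇ σ x) Y ≡ count (λ x → W ⊆ᵇ σ̄ x) Y
    balance = +-cancelˡ-≡ (count (λ x → meets W (σ x)) Y) _ _ (begin
      count (λ x → meets W (σ x)) Y + count (λ x → W ⊆ᵇ σ x) Y  ≡⟨ hke W select-W≢[] ⟩
      2 * k                                                     ≡⟨ sym (length-Separated {Y} {k} sep hke) ⟩
      length Y                                                  ≡⟨ sym (count-complement _ _ Y (λ x → ⊆ᵇ-map-not W (σ x))) ⟩
      count (λ x → meets W (σ x)) Y + count (λ x → W ⊆ᵇ σ̄ x) Y  ∎)
      where open ≡-Reasoning

    W⊆ : {V : List Bool} → W ≡ V → W ⊆ᵇ V ≡ true
    W⊆ W≡V = subst (λ V → W ⊆ᵇ V ≡ true) W≡V (⊆ᵇ-refl W)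

    -- W is σ y′ or σ̄ y′, so y′ is counted on one side of balance; hence some element on the other side has
    -- σ or σ̄ containing W, and by maximality of W it is equal to W.
    complementary-pair : ∃ λ z → ∃ λ y → z ∈ Y × y ∈ Y × σ z ≡ σ̄ y
    complementary-pair with find W-IsSignature
    ... | y′ , y′∈Y , inj₁ W≡σy′
        with 1≤count⇒∈ (λ x → W ⊆ᵇ σ̄ x) Y
               (subst (1 ≤_) balance (∈⇒1≤count (λ x → W ⊆ᵇ σ x) y′∈Y (W⊆ W≡σy′)))
    ...   | y , y∈Y , W⊆σ̄y = y′ , y , y′∈Y , y∈Y , trans (sym W≡σy′) (⊆σ̄⇒≡ y∈Y W⊆σ̄y)
    complementary-pair | y′ , y′∈Y , inj₂ W≡σ̄y′
        with 1≤count⇒∈ (λ x → W ⊆ᵇ σ x) Y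
               (subst (1 ≤_) (sym balance) (∈⇒1≤count (λ x → W ⊆ᵇ σ̄ x) y′∈Y (W⊆ W≡σ̄y′)))
    ...   | z , z∈Y , W⊆σz = z , y′ , z∈Y , y′∈Y , trans (sym (⊆σ⇒≡ z∈Y W⊆σz)) W≡σ̄y′

  complementary-pair : {y₀ : ℕ} {Y₀ : List ℕ} {k : ℕ} → Separated (y₀ ∷ Y₀) → HkeOn (y₀ ∷ Y₀) k →
    ∃ λ z → ∃ λ y → z ∈ y₀ ∷ Y₀ × y ∈ y₀ ∷ Y₀ × σ z ≡ σ̄ y
  complementary-pair {y₀} {Y₀} {k} sep hke with maximal-signature y₀ Y₀
  ... | W , W-IsSignature , weight≤W = MaximalSignature.complementary-pair {y₀ ∷ Y₀} {k} sep hke W W-IsSignature weight≤W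

  Separated-─ : {Y : List ℕ} (x : ℕ) → Separated Y → Separated (Y ─ x)
  Separated-─ x (!Y , sep) = Unique-─ x !Y , All.tabulate λ y∈ → All.lookup sep (proj₁ (∈-─⁻ y∈))

  count-── : (f : ℕ → Bool) {z y : ℕ} {Y : List ℕ} → Unique Y → z ∈ Y → y ∈ Y → y ≢ z →
    count f Y ≡ pairCount f (z , y) + count f ((Y ─ z) ─ y)
  count-── f {z} {y} {Y} !Y z∈Y y∈Y y≢z = begin
    count f Y                                       ≡⟨ count-─ f Y !Y z∈Y ⟩
    bit (f z) + count f (Y ─ z)                     ≡⟨ cong (bit (f z) +_) (count-─ f (Y ─ z) !Y─z (∈-─⁺ y∈Y y≢z)) ⟩
    bit (f z) + (bit (f y) + count f ((Y ─ z) ─ y)) ≡⟨ sym (+-assoc (bit (f z)) _ _) ⟩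
    pairCount f (z , y) + count f ((Y ─ z) ─ y)     ∎
    where
    open ≡-Reasoning
    !Y─z = Unique-─ z !Y

  -- A complementary pair contributes exactly 2 to |⋃ Γ| + |⋂ Γ| for every subcollection Γ.
  HkeOn-── : {Y : List ℕ} {k z y : ℕ} → Unique Y → z ∈ Y → y ∈ Y → y ≢ z → σ z ≡ σ̄ y →
    HkeOn Y (suc k) → HkeOn ((Y ─ z) ─ y) k
  HkeOn-── {Y} {k} {z} {y} !Y z∈Y y∈Y y≢z σz≡σ̄y hke W Γ≢[] = +-cancelˡ-≡ 2 (rest∪ + rest∩) (2 * k) (begin
    2 + (rest∪ + rest∩)                   ≡⟨ cong (_+ (rest∪ + rest∩)) (sym pair≡2) ⟩
    (pair∪ + pair∩) + (rest∪ + rest∩)     ≡⟨ interchange pair∪ pair∩ rest∪ rest∩ ⟩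
    (pair∪ + rest∪) + (pair∩ + rest∩)     ≡⟨ sym (cong₂ _+_ (split ∪) (split ∩)) ⟩
    count ∪ Y + count ∩ Y                 ≡⟨ hke W Γ≢[] ⟩
    2 * suc k                             ≡⟨ *-suc 2 k ⟩
    2 + 2 * k                             ∎)
    where
    open ≡-Reasoning
    ∪ ∩ : ℕ → Bool
    ∪ x = meets W (σ x)
    ∩ x = W ⊆ᵇ σ x
    rest∪ = count ∪ ((Y ─ z) ─ y)
    rest∩ = count ∩ ((Y ─ z) ─ y)
    pair∪ = pairCount ∪ (z , y)
    pair∩ = pairCount ∩ (z , y)
    split : (f : ℕ → Bool) → count f Y ≡ pairCount f (z , y) + count f ((Y ─ z) ─ y)
    split f = count-── f !Y z∈Y y∈Y y≢z
    pair≡2 : pair∪ + pair∩ ≡ 2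
    pair≡2 = pairCount-complementary ∪ ∩
      (trans (cong (W ⊆ᵇ_) σz≡σ̄y) (⊆ᵇ-map-not W (σ y)))
      (trans (cong (W ⊆ᵇ_) (σ≡σ̄-sym σz≡σ̄y)) (⊆ᵇ-map-not W (σ z)))

  ComplementaryPairing : List ℕ → ℕ → Set
  ComplementaryPairing Y k = Σ Pairing λ Q → Unique (elems Q) × length Q ≡ k ×
    (∀ x → x ∈ elems Q ⇔′ x ∈ Y) × All (λ pr → σ (proj₁ pr) ≡ σ̄ (proj₂ pr)) Q

  ComplementaryPairing-∷ : {Y : List ℕ} {k z y : ℕ} → z ∈ Y → y ∈ Y → y ≢ z → σ z ≡ σ̄ y →
    ComplementaryPairing ((Y ─ z) ─ y) k → ComplementaryPairing Y (suc k)
  ComplementaryPairing-∷ {Y} {k} {z} {y} z∈Y y∈Y y≢z σz≡σ̄y (Q , !Q , |Q| , ∈Q⇔ , Q-compl) =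
    (z , y) ∷ Q , (z-fresh ∷ y-fresh ∷ !Q) , cong suc |Q| , ∈⇔ , σz≡σ̄y ∷ Q-compl
    where
    ∈Q⇒ : ∀ {v} → v ∈ elems Q → v ∈ Y × v ≢ z × v ≢ y
    ∈Q⇒ {v} v∈Q with ∈-─⁻ (proj₁ (∈Q⇔ v) v∈Q)
    ... | v∈Y─z , v≢y with ∈-─⁻ {ys = Y} v∈Y─z
    ... | v∈Y , v≢z = v∈Y , v≢z , v≢y
    z-fresh : All (z ≢_) (y ∷ elems Q)
    z-fresh = (λ z≡y → y≢z (sym z≡y)) ∷ All.tabulate (λ v∈Q z≡v → proj₁ (proj₂ (∈Q⇒ v∈Q)) (sym z≡v))
    y-fresh : All (y ≢_) (elems Q)
    y-fresh = All.tabulate (λ v∈Q y≡v → proj₂ (proj₂ (∈Q⇒ v∈Q)) (sym y≡v))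
    ∈⇔ : ∀ x → x ∈ z ∷ y ∷ elems Q ⇔′ x ∈ Y
    ∈⇔ x = to , from
      where
      to : x ∈ z ∷ y ∷ elems Q → x ∈ Y
      to (here refl)         = z∈Y
      to (there (here refl)) = y∈Y
      to (there (there x∈Q)) = proj₁ (∈Q⇒ x∈Q)
      from : x ∈ Y → x ∈ z ∷ y ∷ elems Q
      from x∈Y with x ≟ z | x ≟ y
      ... | yes x≡z | _       = here x≡z
      ... | no  _   | yes x≡y = there (here x≡y)
      ... | no  x≢z | no  x≢y = there (there (proj₂ (∈Q⇔ x) (∈-─⁺ (∈-─⁺ x∈Y x≢z) x≢y)))

  complementaryPairing : (k : ℕ) (Y : List ℕ) → Separated Y → HkeOn Y k → ComplementaryPairing Y k
  complementaryPairing zero    []        _   _   = [] , [] , refl , (λ x → (λ ()) , (λ ())) , []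
  complementaryPairing zero    (y ∷ Y)   sep hke with length-Separated {y ∷ Y} {0} sep hke
  ... | ()
  complementaryPairing (suc k) []        sep hke with length-Separated {[]} {suc k} sep hke
  ... | ()
  complementaryPairing (suc k) (y₀ ∷ Y₀) sep hke with complementary-pair {y₀} {Y₀} {suc k} sep hke
  ... | z , y , z∈Y , y∈Y , σz≡σ̄y =
    ComplementaryPairing-∷ z∈Y y∈Y y≢z σz≡σ̄y
      (complementaryPairing k _ (Separated-─ y (Separated-─ z sep)) (HkeOn-── (proj₁ sep) z∈Y y∈Y y≢z σz≡σ̄y hke))
    where
    y≢z : y ≢ z
    y≢z refl = σ≢σ̄ y σz≡σ̄y

-- Every hke collection consists of transversals of a pairing

⋂⊆⋃ : {Γ : Collection} {x : ℕ} → Γ ≢ [] → ⋂ Γ x → ⋃ Γ x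
⋂⊆⋃ {[]}    Γ≢[] _          = ⊥-elim (Γ≢[] refl)
⋂⊆⋃ {C ∷ Γ} _    (x∈C ∷ _) = here x∈C

elems-++ : (Q R : Pairing) → elems (Q ++ R) ≡ elems Q ++ elems R
elems-++ []            R = refl
elems-++ ((p , q) ∷ Q) R = cong (λ xs → p ∷ q ∷ xs) (elems-++ Q R)

freshPairs : ℕ → List ℕ → Pairing
freshPairs N = map (λ c → c , c + N)

∈-elems-freshPairs⁺ : {N c : ℕ} (cs : List ℕ) → c ∈ cs → c ∈ elems (freshPairs N cs)
∈-elems-freshPairs⁺ (c ∷ cs) (here c≡)  = here c≡
∈-elems-freshPairs⁺ (c ∷ cs) (there c∈) = there (there (∈-elems-freshPairs⁺ cs c∈))

∈-elems-freshPairs⁻ : {N v : ℕ} (cs : List ℕ) → v ∈ elems (freshPairs N cs) →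
  v ∈ cs ⊎ ∃ λ c → c ∈ cs × v ≡ c + N
∈-elems-freshPairs⁻ (c ∷ cs) (here v≡c)         = inj₁ (here v≡c)
∈-elems-freshPairs⁻ (c ∷ cs) (there (here v≡))  = inj₂ (c , here refl , v≡)
∈-elems-freshPairs⁻ (c ∷ cs) (there (there v∈)) with ∈-elems-freshPairs⁻ cs v∈
... | inj₁ v∈cs          = inj₁ (there v∈cs)
... | inj₂ (c′ , c′∈ , e) = inj₂ (c′ , there c′∈ , e)

Unique-elems-freshPairs : {N : ℕ} (cs : List ℕ) → Unique cs → All (_< N) cs → Unique (elems (freshPairs N cs))
Unique-elems-freshPairs []       []           []         = []
Unique-elems-freshPairs {N} (c ∷ cs) (c∉cs ∷ !cs) (c<N ∷ cs<N) =
  (c≢c+N ∷ All.tabulate c≢rest) ∷ All.tabulate c+N≢rest ∷ Unique-elems-freshPairs cs !cs cs<N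
  where
  c≢c+N : c ≢ c + N
  c≢c+N = <⇒≢ (<-≤-trans c<N (m≤n+m N c))
  c≢rest : ∀ {v} → v ∈ elems (freshPairs N cs) → c ≢ v
  c≢rest v∈ with ∈-elems-freshPairs⁻ cs v∈
  ... | inj₁ v∈cs             = All.lookup c∉cs v∈cs
  ... | inj₂ (c′ , _ , refl)  = <⇒≢ (<-≤-trans c<N (m≤n+m N c′))
  c+N≢rest : ∀ {v} → v ∈ elems (freshPairs N cs) → c + N ≢ v
  c+N≢rest v∈ with ∈-elems-freshPairs⁻ cs v∈
  ... | inj₁ v∈cs             = λ e → <⇒≢ (<-≤-trans (All.lookup cs<N v∈cs) (m≤n+m N c)) (sym e)
  ... | inj₂ (c′ , c′∈ , refl) = λ e → All.lookup c∉cs c′∈ (+-cancelʳ-≡ N c c′ e)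

≤-2*-cancel : {n c a : ℕ} → n + 2 * c ≡ 2 * a → c ≤ a × n ≡ 2 * (a ∸ c)
≤-2*-cancel {n} {c} {a} e =
  *-cancelˡ-≤ 2 (subst (2 * c ≤_) e (m≤n+m (2 * c) n)) ,
  trans (sym (m+n∸n≡m n (2 * c))) (trans (cong (_∸ 2 * c) e) (sym (*-distribˡ-∸ 2 a c)))

module HkeEmbedding (A₀ : FinSet) (F₀ : Collection) (α : ℕ) (hke : HkeWith (A₀ ∷ F₀) α) where

  private
    F : Collection
    F = A₀ ∷ F₀

  open ComplementPairing A₀ F₀

  U : List ℕ
  U = deduplicate _≟_ (concat F)

  ∈U⇔⋃ : (x : ℕ) → x ∈ U ⇔′ ⋃ F x
  ∈U⇔⋃ x = (λ x∈U → ∈-concat⁻ F (∈-deduplicate⁻ _≟_ (concat F) x∈U)) ,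
           (λ x∈⋃ → ∈-deduplicate⁺ _≟_ (∈-concat⁺ x∈⋃))

  !U : Unique U
  !U = deduplicate-! (concat F)

  core : List ℕ
  core = filterᵇ (⋂ᵇ F) U

  rest : List ℕ
  rest = filterᵇ (not ∘ ⋂ᵇ F) U

  ∈core⇒⋂ : {c : ℕ} → c ∈ core → ⋂ F c
  ∈core⇒⋂ {c} c∈ = ⋂ᵇ-sound F c (proj₂ (∈-filterᵇ⁻ {xs = U} c∈))

  ∈rest⇒¬⋂ : {y : ℕ} → y ∈ rest → ¬ ⋂ F y
  ∈rest⇒¬⋂ {y} y∈ y∈⋂
    with trans (sym (cong not (⋂ᵇ-complete F y y∈⋂))) (proj₂ (∈-filterᵇ⁻ {not ∘ ⋂ᵇ F} {xs = U} y∈))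
  ... | ()

  rest-Separated : Separated rest
  rest-Separated =
    Unique.filter⁺ _ !U ,
    All.tabulate λ y∈ → proj₁ (∈U⇔⋃ _) (proj₁ (∈-filterᵇ⁻ {xs = U} y∈)) ,
                        ¬All⇒Any¬ (λ A → _ ∈? A) F (∈rest⇒¬⋂ y∈)

  -- Elements of the core lie in every member, so they add |core| to both |⋃ Γ| and |⋂ Γ|.
  rest-hke : ∀ W → select W F ≢ [] →
    length core ≤ α × count (λ x → meets W (σ x)) rest + count (λ x → W ⊆ᵇ σ x) rest ≡ 2 * (α ∸ length core)
  rest-hke W Γ≢[]
    with proj₂ hke (select W F) Γ≢[] (All-∈ᶜ⇒⊆ᶜ (All.tabulate λ C∈Γ → lose (select-⊆ W F C∈Γ) ≐-refl))
  ... | u , i , |⋃| , |⋂| , u+i≡2α = ≤-2*-cancel {m + s} {length core} {α} (begin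
    m + s + 2 * length core                     ≡⟨ cong (m + s +_) (cong (length core +_) (+-identityʳ (length core))) ⟩
    (m + s) + (length core + length core)       ≡⟨ interchange m s (length core) (length core) ⟩
    (m + length core) + (s + length core)       ≡⟨ cong₂ _+_ (sym u≡) (sym i≡) ⟩
    u + i                                       ≡⟨ u+i≡2α ⟩
    2 * α                                       ∎)
    where
    open ≡-Reasoning
    Γ = select W F
    m = count (λ x → meets W (σ x)) rest
    s = count (λ x → W ⊆ᵇ σ x) rest
    ⋃Γ⊆U : ∀ x → ⋃ Γ x → x ∈ U
    ⋃Γ⊆U x x∈⋃ with find x∈⋃
    ... | C , C∈Γ , x∈C = proj₂ (∈U⇔⋃ x) (lose (select-⊆ W F C∈Γ) x∈C)
    ⋂Γ⊆U : ∀ x → ⋂ Γ x → x ∈ U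
    ⋂Γ⊆U x x∈⋂ = ⋃Γ⊆U x (⋂⊆⋃ Γ≢[] x∈⋂)
    core⊆⋂Γ : ∀ {c} → c ∈ core → ⋂ Γ c
    core⊆⋂Γ c∈ = All.tabulate λ C∈Γ → All.lookup (∈core⇒⋂ c∈) (select-⊆ W F C∈Γ)
    core⊆⋃Γ : ∀ {c} → c ∈ core → ⋃ Γ c
    core⊆⋃Γ c∈ = ⋂⊆⋃ Γ≢[] (core⊆⋂Γ c∈)
    u≡ : u ≡ m + length core
    u≡ = begin
      u                                     ≡⟨ HasCard-unique |⋃| (HasCard-count (⋃ᵇ Γ) !U ⋃Γ⊆U (λ x _ → ⋃ᵇ⇔⋃ Γ x)) ⟩
      count (⋃ᵇ Γ) U                        ≡⟨ count-partition (⋃ᵇ Γ) (⋂ᵇ F) U ⟩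
      count (⋃ᵇ Γ) rest + count (⋃ᵇ Γ) core ≡⟨ cong₂ _+_ (count-cong (⋃ᵇ-select W F) rest)
                                                 (count-all (⋃ᵇ Γ) core λ c c∈ → ⋃ᵇ-complete Γ c (core⊆⋃Γ c∈)) ⟩
      m + length core                       ∎
    i≡ : i ≡ s + length core
    i≡ = begin
      i                                     ≡⟨ HasCard-unique |⋂| (HasCard-count (⋂ᵇ Γ) !U ⋂Γ⊆U (λ x _ → ⋂ᵇ⇔⋂ Γ x)) ⟩
      count (⋂ᵇ Γ) U                        ≡⟨ count-partition (⋂ᵇ Γ) (⋂ᵇ F) U ⟩
      count (⋂ᵇ Γ) rest + count (⋂ᵇ Γ) core ≡⟨ cong₂ _+_ (count-cong (⋂ᵇ-select W F) rest)
                                                 (count-all (⋂ᵇ Γ) core λ c c∈ → ⋂ᵇ-complete Γ c (core⊆⋂Γ c∈)) ⟩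
      s + length core                       ∎

  core≤α : length core ≤ α
  core≤α = proj₁ (rest-hke full (subst (_≢ []) (sym (select-all F)) λ ()))

  rest-HkeOn : HkeOn rest (α ∸ length core)
  rest-HkeOn W Γ≢[] = proj₂ (rest-hke W Γ≢[])

  -- A bound above every element of ⋃ F, so that c + N is a fresh partner for each core element c.
  N : ℕ
  N = suc (max 0 U)

  U<N : {x : ℕ} → x ∈ U → x < N
  U<N x∈U = s≤s (All.lookup (xs≤max 0 U) x∈U)

  transversalPairing : Σ Pairing λ P → Unique (elems P) × length P ≡ α × All (IsTransversal P) F
  transversalPairing with complementaryPairing (α ∸ length core) rest rest-Separated rest-HkeOn
  ... | Q , !Q , |Q| , ∈Q⇔ , Q-compl =
    Q ++ R ,
    subst Unique (sym (elems-++ Q R)) (Unique.++⁺ !Q !R disjoint) ,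
    trans (length-++ Q) (trans (cong₂ _+_ |Q| (length-map _ core)) (m∸n+n≡m core≤α)) ,
    All.tabulate transversal
    where
    R = freshPairs N core
    !R : Unique (elems R)
    !R = Unique-elems-freshPairs core (Unique.filter⁺ _ !U)
           (All.tabulate λ c∈ → U<N (proj₁ (∈-filterᵇ⁻ {xs = U} c∈)))
    Q⊆rest : ∀ {v} → v ∈ elems Q → v ∈ rest
    Q⊆rest {v} = proj₁ (∈Q⇔ v)
    disjoint : ∀ {v} → ¬ (v ∈ elems Q × v ∈ elems R)
    disjoint (v∈Q , v∈R) with ∈-elems-freshPairs⁻ core v∈R
    ... | inj₁ v∈core            = ∈rest⇒¬⋂ (Q⊆rest v∈Q) (∈core⇒⋂ v∈core)
    ... | inj₂ (c , _ , refl)    = <⇒≢ (<-≤-trans (U<N (proj₁ (∈-filterᵇ⁻ {xs = U} (Q⊆rest v∈Q)))) (m≤n+m N c)) refl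
    ∈-elems-++ˡ : ∀ {x} → x ∈ elems Q → x ∈ elems (Q ++ R)
    ∈-elems-++ˡ {x} x∈Q = subst (x ∈_) (sym (elems-++ Q R)) (∈-++⁺ˡ x∈Q)
    ∈-elems-++ʳ : ∀ {x} → x ∈ elems R → x ∈ elems (Q ++ R)
    ∈-elems-++ʳ {x} x∈R = subst (x ∈_) (sym (elems-++ Q R)) (∈-++⁺ʳ (elems Q) x∈R)
    transversal : ∀ {A} → A ∈ F → IsTransversal (Q ++ R) A
    transversal {A} A∈F = A⊆P , All.++⁺ Q-oneOf R-oneOf
      where
      A⊆P : ∀ x → x ∈ A → x ∈ elems (Q ++ R)
      A⊆P x x∈A with ⋂ᵇ F x in x∈⋂ | proj₂ (∈U⇔⋃ x) (lose A∈F x∈A)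
      ... | true  | x∈U = ∈-elems-++ʳ (∈-elems-freshPairs⁺ core (∈-filterᵇ⁺ x∈U x∈⋂))
      ... | false | x∈U = ∈-elems-++ˡ (proj₂ (∈Q⇔ x) (∈-filterᵇ⁺ x∈U (cong not x∈⋂)))
      Q-oneOf : All (λ pr → OneOf pr A) Q
      Q-oneOf = All.map (λ σz≡σ̄y → All.lookup (σ≡σ̄⇒OneOf σz≡σ̄y) A∈F) Q-compl
      R-oneOf : All (λ pr → OneOf pr A) R
      R-oneOf = All.map⁺ (All.tabulate λ {c} c∈ →
        inj₁ (All.lookup (∈core⇒⋂ c∈) A∈F ,
              λ c+N∈A → <⇒≢ (<-≤-trans (U<N (proj₂ (∈U⇔⋃ _) (lose A∈F c+N∈A))) (m≤n+m N c)) refl))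

hke⇒transversalPairing : (F : Collection) (α : ℕ) → F ≢ [] → HkeWith F α →
  Σ Pairing λ P → Unique (elems P) × length P ≡ α × All (IsTransversal P) F
hke⇒transversalPairing []        α F≢[] _   = ⊥-elim (F≢[] refl)
hke⇒transversalPairing (A₀ ∷ F₀) α _    hke = HkeEmbedding.transversalPairing A₀ F₀ α hke

-- Maximal hke collections are transversal families

IsTransversalFamilyOf : Pairing → ℕ → Collection → Set
IsTransversalFamilyOf P α F = Unique (elems P) × length P ≡ α × (∀ B → B ∈ᶜ F ⇔′ IsTransversal P B)

_≐?_ : (A B : FinSet) → Dec (A ≐ B)
A ≐? B = map′ (λ (A⊆B , B⊆A) x → (λ x∈A → A⊆B x∈A) , (λ x∈B → B⊆A x∈B))
              (λ A≐B → (λ {x} → proj₁ (A≐B x)) , (λ {x} → proj₂ (A≐B x)))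
              (A ⊆? B ×-dec B ⊆? A)

_∈ᶜ?_ : (A : FinSet) (F : Collection) → Dec (A ∈ᶜ F)
A ∈ᶜ? F = any? (A ≐?_) F

transversals-hke : (P : Pairing) → Unique (elems P) → 0 < length P → (G : Collection) →
  (∀ B → B ∈ᶜ G → IsTransversal P B) → HkeWith G (length P)
transversals-hke P !P 0<n G G⊆T = 0<n , λ Γ Γ≢[] Γ⊆G →
  transversals-UnionIntersectionSum P !P Γ Γ≢[] (All.tabulate λ {C} C∈Γ → G⊆T C (Γ⊆G C (lose C∈Γ ≐-refl)))

transversalFamily⇒MaximalHke : {F : Collection} {α : ℕ} {P : Pairing} → Relevant F α →
  IsTransversalFamilyOf P α F → MaximalHke F
transversalFamily⇒MaximalHke {F} {α} {P} (_ , 0<α , _) (!P , refl , F≡T) =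
  (α , transversals-hke P !P 0<α F (λ B → proj₁ (F≡T B))) , transversalFamily-maximal F P !P F≡T

maximal⇒transversalFamily : {F : Collection} {α : ℕ} {P : Pairing} → Relevant F α → MaximalHke F →
  Unique (elems P) → All (IsTransversal P) F → IsTransversalFamilyOf P α F
maximal⇒transversalFamily {[]} (F≢[] , _) _ _ _ = ⊥-elim (F≢[] refl)
maximal⇒transversalFamily {F@(A ∷ _)} {α} {P} (_ , 0<α , |F|) (_ , maximal) !P F-transversals =
  !P , |P|≡α , λ B → ∈ᶜ⇒T B , T⇒∈ᶜ B
  where
  ∈ᶜ⇒T : ∀ B → B ∈ᶜ F → IsTransversal P B
  ∈ᶜ⇒T B B∈F with find B∈F
  ... | C , C∈F , B≐C = IsTransversal-≐ (≐-sym B≐C) (All.lookup F-transversals C∈F)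
  |P|≡α : length P ≡ α
  |P|≡α = HasCard-unique (IsTransversal-card P !P (∈ᶜ⇒T A (here ≐-refl))) (|F| A (here ≐-refl))
  T⇒∈ᶜ : ∀ B → IsTransversal P B → B ∈ᶜ F
  T⇒∈ᶜ B t with B ∈ᶜ? F
  ... | yes B∈F = B∈F
  ... | no  B∉F = ⊥-elim (maximal (B ∷ F) (length P , B∷F-hke) ((λ C C∈F → there C∈F) , B , here ≐-refl , B∉F))
    where
    B∷F-transversal : ∀ C → C ∈ᶜ (B ∷ F) → IsTransversal P C
    B∷F-transversal C (here C≐B)  = IsTransversal-≐ (≐-sym C≐B) t
    B∷F-transversal C (there C∈F) = ∈ᶜ⇒T C C∈F
    B∷F-hke : HkeWith (B ∷ F) (length P)
    B∷F-hke = transversals-hke P !P (subst (0 <_) (sym |P|≡α) 0<α) (B ∷ F) B∷F-transversal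

MaximalHke⇒transversalFamily : {F : Collection} {α : ℕ} → Relevant F α → MaximalHke F →
  Σ Pairing λ P → IsTransversalFamilyOf P α F
MaximalHke⇒transversalFamily {F} rel@(F≢[] , _) maximal@((α′ , hke) , _) =
  let (P , !P , _ , F-transversals) = hke⇒transversalPairing F α′ F≢[] hke
  in P , maximal⇒transversalFamily rel maximal !P F-transversals

transversalFamily-⋃ : {F : Collection} {α : ℕ} {P : Pairing} → IsTransversalFamilyOf P α F →
  (x : ℕ) → ⋃ F x ⇔′ x ∈ elems P
transversalFamily-⋃ {F} {α} {P} (!P , _ , F≡T) x = to , from
  where
  to : ⋃ F x → x ∈ elems P
  to x∈⋃ with find x∈⋃
  ... | C , C∈F , x∈C = proj₁ (proj₁ (F≡T C) (lose C∈F ≐-refl)) x x∈C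
  from : x ∈ elems P → ⋃ F x
  from x∈P with find (proj₂ (F≡T (through x P)) (choose-IsTransversal _ P !P))
  ... | C , C∈F , T≐C = lose C∈F (proj₁ (T≐C x) (∈-through P x∈P))

transversalFamily-|⋃| : {F : Collection} {α : ℕ} {P : Pairing} → IsTransversalFamilyOf P α F → HasCard (⋃ F) (2 * α)
transversalFamily-|⋃| {F} {α} {P} T@(!P , refl , _) =
  HasCard-cong (λ x → proj₂ (transversalFamily-⋃ T x) , proj₁ (transversalFamily-⋃ T x))
    (subst (HasCard _) (length-elems P) (HasCard-list !P))

-- Pairings as equivalence relations with classes of size two

PairClasses : Collection → ℕ → (ℕ → ℕ → Set) → Set
PairClasses F α R =
  IsEquivOn (⋃ F) R × NumClasses (⋃ F) R α × ClassesOfSizeTwo (⋃ F) R × IsTransversalFamily F (⋃ F) R α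

IsClassTransversal : Pred → (ℕ → ℕ → Set) → ℕ → FinSet → Set
IsClassTransversal U R α B = (∀ x → x ∈ B → U x) × HasCard (_∈ B) α × (∀ x → U x → ∃[ y ] (y ∈ B × R x y))

SamePair : Pairing → ℕ → ℕ → Set
SamePair P x y = Any (λ pr → x ∈ pairElems pr × y ∈ pairElems pr) P

module SamePairClasses (P : Pairing) (!P : Unique (elems P)) {U : Pred} (U⇔P : ∀ x → U x ⇔′ x ∈ elems P) where

  private
    toE : ∀ {x} → U x → x ∈ elems P
    toE {x} = proj₁ (U⇔P x)

    fromE : ∀ {x} → x ∈ elems P → U x
    fromE {x} = proj₂ (U⇔P x)

  SamePair-refl : {x : ℕ} → x ∈ elems P → SamePair P x x
  SamePair-refl x∈P = let (pr , pr∈P , x∈pr) = ∈-elems⁻ P x∈P in lose pr∈P (x∈pr , x∈pr)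

  SamePair-sym : {x y : ℕ} → SamePair P x y → SamePair P y x
  SamePair-sym = Any.map (λ (x∈ , y∈) → y∈ , x∈)

  SamePair-pair : {x y : ℕ} {pr : ℕ × ℕ} → pr ∈ P → x ∈ pairElems pr → SamePair P x y → y ∈ pairElems pr
  SamePair-pair pr∈P x∈pr xy with find xy
  ... | pr′ , pr′∈P , x∈pr′ , y∈pr′ with pair-unique P !P pr∈P pr′∈P x∈pr x∈pr′
  ... | refl = y∈pr′

  SamePair-trans : {x y z : ℕ} → SamePair P x y → SamePair P y z → SamePair P x z
  SamePair-trans xy yz with find xy
  ... | pr , pr∈P , x∈pr , y∈pr = lose pr∈P (x∈pr , SamePair-pair pr∈P y∈pr yz)

  isEquiv : IsEquivOn U (SamePair P)
  isEquiv = (λ x Ux → SamePair-refl (toE Ux)) , (λ _ _ _ _ → SamePair-sym) , (λ _ _ _ _ _ _ → SamePair-trans)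

  firsts-apart : (Q : Pairing) → (∀ {pr} → pr ∈ Q → pr ∈ P) → Unique (elems Q) →
    AllPairs (λ a b → ¬ SamePair P a b) (map proj₁ Q)
  firsts-apart []            _   []                  = []
  firsts-apart ((p , q) ∷ Q) Q⊆P ((_ ∷ p∉) ∷ q∉ ∷ !Q) =
    All.map⁺ (All.tabulate apart) ∷ firsts-apart Q (λ pr∈Q → Q⊆P (there pr∈Q)) !Q
    where
    apart : ∀ {pr′} → pr′ ∈ Q → ¬ SamePair P p (proj₁ pr′)
    apart pr′∈Q same with SamePair-pair (Q⊆P (here refl)) (here refl) same
    ... | here p′≡p         = All.lookup p∉ (∈-elems⁺ Q pr′∈Q (here refl)) (sym p′≡p)
    ... | there (here p′≡q) = All.lookup q∉ (∈-elems⁺ Q pr′∈Q (here refl)) (sym p′≡q)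

  numClasses : NumClasses U (SamePair P) (length P)
  numClasses =
    map proj₁ P ,
    All.map⁺ (All.tabulate λ pr∈P → fromE (∈-elems⁺ P pr∈P (here refl))) ,
    firsts-apart P (λ pr∈P → pr∈P) !P ,
    cover ,
    length-map proj₁ P
    where
    cover : ∀ x → U x → Any (SamePair P x) (map proj₁ P)
    cover x Ux with ∈-elems⁻ P (toE Ux)
    ... | (p , q) , pr∈P , x∈pr = lose (∈-map⁺ proj₁ pr∈P) (lose pr∈P (x∈pr , here refl))

  classesOfSizeTwo : ClassesOfSizeTwo U (SamePair P)
  classesOfSizeTwo x Ux with ∈-elems⁻ P (toE Ux)
  ... | (p , q) , pr∈P , x∈pr =
    p ∷ q ∷ [] , (pair-≢ P !P pr∈P ∷ []) ∷ [] ∷ [] ,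
    (λ y → (λ y∈pr → fromE (∈-elems⁺ P pr∈P y∈pr) , lose pr∈P (x∈pr , y∈pr)) ,
           (λ (_ , same) → SamePair-pair pr∈P x∈pr same)) ,
    refl

  MeetsAllClasses⇔Hits : (B : FinSet) → (∀ x → U x → ∃[ y ] (y ∈ B × SamePair P x y)) ⇔′ Hits P B
  MeetsAllClasses⇔Hits B = to , from
    where
    to : (∀ x → U x → ∃[ y ] (y ∈ B × SamePair P x y)) → Hits P B
    to meets = All.tabulate hit
      where
      hit : ∀ {pr} → pr ∈ P → Any (_∈ B) (pairElems pr)
      hit {p , q} pr∈P with meets p (fromE (∈-elems⁺ P pr∈P (here refl)))
      ... | y , y∈B , same = lose (SamePair-pair pr∈P (here refl) same) y∈B
    from : Hits P B → ∀ x → U x → ∃[ y ] (y ∈ B × SamePair P x y)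
    from hits x Ux with ∈-elems⁻ P (toE Ux)
    ... | pr , pr∈P , x∈pr with find (All.lookup hits pr∈P)
    ...   | y , y∈pr , y∈B = y , y∈B , lose pr∈P (x∈pr , y∈pr)

  IsClassTransversal⇔IsTransversal : (B : FinSet) → IsClassTransversal U (SamePair P) (length P) B ⇔′ IsTransversal P B
  IsClassTransversal⇔IsTransversal B = to , from
    where
    to : IsClassTransversal U (SamePair P) (length P) B → IsTransversal P B
    to (B⊆U , |B| , meets) =
      IsHittingSet⇒IsTransversal P !P ((λ x x∈B → toE (B⊆U x x∈B)) , |B| , proj₁ (MeetsAllClasses⇔Hits B) meets)
    from : IsTransversal P B → IsClassTransversal U (SamePair P) (length P) B
    from t with IsTransversal⇒IsHittingSet P !P t
    ... | B⊆P , |B| , hits = (λ x x∈B → fromE (B⊆P x x∈B)) , |B| , proj₂ (MeetsAllClasses⇔Hits B) hits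

transversalFamily⇒PairClasses : {F : Collection} {α : ℕ} {P : Pairing} → IsTransversalFamilyOf P α F →
  PairClasses F α (SamePair P)
transversalFamily⇒PairClasses {F} {P = P} T@(!P , refl , F≡T) =
  isEquiv , numClasses , classesOfSizeTwo ,
  λ B → (λ B∈F → proj₂ (IsClassTransversal⇔IsTransversal B) (proj₁ (F≡T B) B∈F)) ,
        (λ B-tr → proj₂ (F≡T B) (proj₁ (IsClassTransversal⇔IsTransversal B) B-tr))
  where open SamePairClasses P !P (transversalFamily-⋃ T)

module _ {U : Pred} {R R′ : ℕ → ℕ → Set} (R⇔R′ : ∀ x y → U x → U y → R x y ⇔′ R′ x y) where

  private
    to : ∀ {x y} → U x → U y → R x y → R′ x y
    to {x} {y} Ux Uy = proj₁ (R⇔R′ x y Ux Uy)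

    from : ∀ {x y} → U x → U y → R′ x y → R x y
    from {x} {y} Ux Uy = proj₂ (R⇔R′ x y Ux Uy)

  IsEquivOn-cong : IsEquivOn U R → IsEquivOn U R′
  IsEquivOn-cong (refl′ , sym′ , trans′) =
    (λ x Ux → to Ux Ux (refl′ x Ux)) ,
    (λ x y Ux Uy r → to Uy Ux (sym′ x y Ux Uy (from Ux Uy r))) ,
    (λ x y z Ux Uy Uz r s → to Ux Uz (trans′ x y z Ux Uy Uz (from Ux Uy r) (from Uy Uz s)))

  NumClasses-cong : {k : ℕ} → NumClasses U R k → NumClasses U R′ k
  NumClasses-cong (reps , reps⊆U , apart , cover , |reps|) =
    reps , reps⊆U , apart′ reps⊆U apart , (λ x Ux → cover′ reps⊆U Ux (cover x Ux)) , |reps|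
    where
    apart′ : ∀ {rs} → All U rs → AllPairs (λ x y → ¬ R x y) rs → AllPairs (λ x y → ¬ R′ x y) rs
    apart′ []           []             = []
    apart′ (Ur ∷ Urs) (r-apart ∷ rs-apart) =
      All.tabulate (λ s∈ r′ → All.lookup r-apart s∈ (from Ur (All.lookup Urs s∈) r′)) ∷ apart′ Urs rs-apart
    cover′ : ∀ {rs x} → All U rs → U x → Any (R x) rs → Any (R′ x) rs
    cover′ (Ur ∷ _)   Ux (here r)  = here (to Ux Ur r)
    cover′ (_ ∷ Urs) Ux (there r) = there (cover′ Urs Ux r)

  ClassesOfSizeTwo-cong : ClassesOfSizeTwo U R → ClassesOfSizeTwo U R′
  ClassesOfSizeTwo-cong two x Ux =
    HasCard-cong (λ y → (λ (Uy , r) → Uy , to Ux Uy r) , (λ (Uy , r′) → Uy , from Ux Uy r′)) (two x Ux)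

  IsClassTransversal-cong : {k : ℕ} {B : FinSet} → IsClassTransversal U R k B → IsClassTransversal U R′ k B
  IsClassTransversal-cong (B⊆U , |B| , meets) =
    B⊆U , |B| , λ x Ux → let (y , y∈B , r) = meets x Ux in y , y∈B , to Ux (B⊆U y y∈B) r

module _ {F : Collection} {α : ℕ} {R R′ : ℕ → ℕ → Set} (R⇔R′ : ∀ x y → ⋃ F x → ⋃ F y → R x y ⇔′ R′ x y) where

  private
    R′⇔R : ∀ x y → ⋃ F x → ⋃ F y → R′ x y ⇔′ R x y
    R′⇔R x y Ux Uy = proj₂ (R⇔R′ x y Ux Uy) , proj₁ (R⇔R′ x y Ux Uy)

  PairClasses-cong : PairClasses F α R → PairClasses F α R′
  PairClasses-cong (equiv , classes , two , F≡T) =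
    IsEquivOn-cong R⇔R′ equiv , NumClasses-cong R⇔R′ classes , ClassesOfSizeTwo-cong R⇔R′ two ,
    λ B → (λ B∈F → IsClassTransversal-cong R⇔R′ (proj₁ (F≡T B) B∈F)) ,
          (λ B-tr → proj₂ (F≡T B) (IsClassTransversal-cong R′⇔R B-tr))

pick-avoiding : {x y : ℕ} (pr : ℕ × ℕ) → x ∈ pairElems pr → y ∈ pairElems pr → x ≢ y → pick (firstUnless y) pr ≡ x
pick-avoiding (p , q) (here refl)         (here refl)         x≢y = ⊥-elim (x≢y refl)
pick-avoiding (p , q) (here refl)         (there (here refl)) x≢y = pick-firstUnless x≢y
pick-avoiding (p , q) (there (here refl)) (here refl)         x≢y = pick-firstUnless-self {p}
pick-avoiding (p , q) (there (here refl)) (there (here refl)) x≢y = ⊥-elim (x≢y refl)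

avoiding-DiffIsSingleton : (P : Pairing) → Unique (elems P) → {x y : ℕ} {pr : ℕ × ℕ} → pr ∈ P →
  x ∈ pairElems pr → y ∈ pairElems pr → x ≢ y → DiffIsSingleton (avoiding y P) (avoiding x P) x
avoiding-DiffIsSingleton P !P {x} {y} {pr} pr∈P x∈pr y∈pr x≢y z = to , from
  where
  from : z ≡ x → z ∈ avoiding y P × z ∉ avoiding x P
  from refl =
    ∈-choose⁺ (firstUnless y) P pr∈P (sym (pick-avoiding pr x∈pr y∈pr x≢y)) ,
    λ x∈ → x≢y (trans (∈-choose⇒pick (firstUnless x) P !P pr∈P x∈pr x∈)
                      (pick-avoiding pr y∈pr x∈pr (λ y≡x → x≢y (sym y≡x))))
  to : z ∈ avoiding y P × z ∉ avoiding x P → z ≡ x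
  to (z∈ , z∉) with ∈-map⁻ (pick (firstUnless y)) z∈
  ... | (p′ , q′) , pr′∈P , refl with x ∈? pairElems (p′ , q′)
  ...   | yes x∈pr′ with pair-unique P !P pr∈P pr′∈P x∈pr x∈pr′
  ...     | refl = pick-avoiding pr x∈pr y∈pr x≢y
  to (z∈ , z∉) | (p′ , q′) , pr′∈P , refl | no x∉pr′ =
    ⊥-elim (z∉ (∈-choose⁺ (firstUnless x) P pr′∈P (trans (pick-firstUnless p′≢y) (sym (pick-firstUnless p′≢x)))))
    where
    p′≢x : p′ ≢ x
    p′≢x refl = x∉pr′ (here refl)
    p′≢y : p′ ≢ y
    p′≢y refl with pair-unique P !P pr′∈P pr∈P (here refl) y∈pr
    ... | refl = x∉pr′ x∈pr

OneOf-partner : {pr : ℕ × ℕ} {A D : FinSet} {x : ℕ} → OneOf pr A → OneOf pr D → x ∈ pairElems pr → x ∈ A → x ∉ D →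
  ∃ λ x′ → x′ ∈ pairElems pr × x′ ∈ D × x′ ∉ A
OneOf-partner (inj₂ (p∉A , _))  _                  (here refl)         x∈A _   = ⊥-elim (p∉A x∈A)
OneOf-partner (inj₁ _)          (inj₁ (p∈D , _))   (here refl)         _   x∉D = ⊥-elim (x∉D p∈D)
OneOf-partner (inj₁ (_ , q∉A))  (inj₂ (_ , q∈D))   (here refl)         _   _   = _ , there (here refl) , q∈D , q∉A
OneOf-partner (inj₁ (_ , q∉A))  _                  (there (here refl)) x∈A _   = ⊥-elim (q∉A x∈A)
OneOf-partner (inj₂ (p∉A , _))  (inj₁ (p∈D , _))   (there (here refl)) _   _   = _ , here refl , p∈D , p∉A
OneOf-partner (inj₂ _)          (inj₂ (_ , q∈D))   (there (here refl)) _   x∉D = ⊥-elim (x∉D q∈D)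

DiffIsSingleton-≐ : {A A′ D D′ : FinSet} {x : ℕ} → A ≐ A′ → D ≐ D′ → DiffIsSingleton A D x → DiffIsSingleton A′ D′ x
DiffIsSingleton-≐ A≐ D≐ A∖D z =
  (λ (z∈A′ , z∉D′) → proj₁ (A∖D z) (proj₂ (A≐ z) z∈A′ , λ z∈D → z∉D′ (proj₁ (D≐ z) z∈D))) ,
  (λ z≡x → let (z∈A , z∉D) = proj₂ (A∖D z) z≡x in proj₁ (A≐ z) z∈A , λ z∈D′ → z∉D (proj₂ (D≐ z) z∈D′))

≈⇔SamePair : {F : Collection} {α : ℕ} {P : Pairing} → IsTransversalFamilyOf P α F →
  ∀ x y → ⋃ F x → ⋃ F y → SamePair P x y ⇔′ ≈[ F ] x y
≈⇔SamePair {F} {α} {P} T@(!P , _ , F≡T) x y Ux Uy = to , from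
  where
  open SamePairClasses P !P (transversalFamily-⋃ T) using (SamePair-refl)
  from : ≈[ F ] x y → SamePair P x y
  from (inj₁ refl) = SamePair-refl (proj₁ (transversalFamily-⋃ T x) Ux)
  from (inj₂ (A , D , A∈F , D∈F , A∖D , D∖A)) with ∈-elems⁻ P (proj₁ (transversalFamily-⋃ T x) Ux)
  ... | pr , pr∈P , x∈pr
      with OneOf-partner (All.lookup (proj₂ (proj₁ (F≡T A) (lose A∈F ≐-refl))) pr∈P)
                         (All.lookup (proj₂ (proj₁ (F≡T D) (lose D∈F ≐-refl))) pr∈P)
                         x∈pr (proj₁ (proj₂ (A∖D x) refl)) (proj₂ (proj₂ (A∖D x) refl))
  ... | x′ , x′∈pr , x′∈D , x′∉A =
    lose pr∈P (x∈pr , subst (_∈ pairElems pr) (proj₁ (D∖A x′) (x′∈D , x′∉A)) x′∈pr)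
  to : SamePair P x y → ≈[ F ] x y
  to same with x ≟ y
  ... | yes x≡y = inj₁ x≡y
  ... | no  x≢y with find same
  ...   | pr , pr∈P , x∈pr , y∈pr
        with find (proj₂ (F≡T (avoiding y P)) (choose-IsTransversal _ P !P))
           | find (proj₂ (F≡T (avoiding x P)) (choose-IsTransversal _ P !P))
  ...   | A , A∈F , avoid-y≐A | D , D∈F , avoid-x≐D =
    inj₂ (A , D , A∈F , D∈F ,
          DiffIsSingleton-≐ avoid-y≐A avoid-x≐D (avoiding-DiffIsSingleton P !P pr∈P x∈pr y∈pr x≢y) ,
          DiffIsSingleton-≐ avoid-x≐D avoid-y≐A (avoiding-DiffIsSingleton P !P pr∈P y∈pr x∈pr (λ y≡x → x≢y (sym y≡x))))

module ClassPairing {F : Collection} {α : ℕ} {R : ℕ → ℕ → Set} (C : PairClasses F α R) where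

  private
    U : Pred
    U = ⋃ F

    R-refl : ∀ {x} → U x → R x x
    R-refl {x} = proj₁ (proj₁ C) x

    R-sym : ∀ {x y} → U x → U y → R x y → R y x
    R-sym {x} {y} = proj₁ (proj₂ (proj₁ C)) x y

    R-trans : ∀ {x y z} → U x → U y → U z → R x y → R y z → R x z
    R-trans {x} {y} {z} = proj₂ (proj₂ (proj₁ C)) x y z

  IsPartner : ℕ → ℕ → Set
  IsPartner r r′ = U r′ × R r r′ × r ≢ r′ × (∀ y → U y → R r y → y ∈ pairElems (r , r′))

  partner : (r : ℕ) → U r → Σ ℕ (IsPartner r)
  partner r Ur with proj₁ (proj₂ (proj₂ C)) r Ur
  ... | a ∷ b ∷ [] , (a≢b ∷ []) ∷ _ , class⇔ , refl with proj₂ (class⇔ r) (Ur , R-refl Ur)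
  ...   | here refl =
    b , proj₁ (proj₁ (class⇔ b) (there (here refl))) , proj₂ (proj₁ (class⇔ b) (there (here refl))) , a≢b ,
    λ y Uy Rry → proj₂ (class⇔ y) (Uy , Rry)
  ...   | there (here refl) =
    a , proj₁ (proj₁ (class⇔ a) (here refl)) , proj₂ (proj₁ (class⇔ a) (here refl)) , (λ b≡a → a≢b (sym b≡a)) ,
    λ y Uy Rry → swap (proj₂ (class⇔ y) (Uy , Rry))
    where
    swap : ∀ {y} → y ∈ a ∷ b ∷ [] → y ∈ b ∷ a ∷ []
    swap (here y≡a)         = there (here y≡a)
    swap (there (here y≡b)) = here y≡b

  pairing : (rs : List ℕ) → All U rs → Pairing
  pairing []       []         = []
  pairing (r ∷ rs) (Ur ∷ Urs) = (r , proj₁ (partner r Ur)) ∷ pairing rs Urs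

  length-pairing : (rs : List ℕ) (Urs : All U rs) → length (pairing rs Urs) ≡ length rs
  length-pairing []       []         = refl
  length-pairing (r ∷ rs) (Ur ∷ Urs) = cong suc (length-pairing rs Urs)

  ∈-pairing⁻ : {rs : List ℕ} {Urs : All U rs} {pr : ℕ × ℕ} → pr ∈ pairing rs Urs →
    proj₁ pr ∈ rs × U (proj₁ pr) × IsPartner (proj₁ pr) (proj₂ pr)
  ∈-pairing⁻ {r ∷ rs} {Ur ∷ Urs} (here refl)  = here refl , Ur , proj₂ (partner r Ur)
  ∈-pairing⁻ {r ∷ rs} {Ur ∷ Urs} (there pr∈) = let (r∈ , rest) = ∈-pairing⁻ pr∈ in there r∈ , rest

  related-to-first : {rs : List ℕ} {Urs : All U rs} {pr : ℕ × ℕ} {y : ℕ} → pr ∈ pairing rs Urs →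
    y ∈ pairElems pr → U (proj₁ pr) × U y × R (proj₁ pr) y
  related-to-first pr∈ (here refl) = let (_ , Ur , _) = ∈-pairing⁻ pr∈ in Ur , Ur , R-refl Ur
  related-to-first pr∈ (there (here refl)) = let (_ , Ur , Ur′ , Rrr′ , _) = ∈-pairing⁻ pr∈ in Ur , Ur′ , Rrr′

  Unique-pairing : (rs : List ℕ) (Urs : All U rs) → AllPairs (λ x y → ¬ R x y) rs → Unique (elems (pairing rs Urs))
  Unique-pairing []       []         []                 = []
  Unique-pairing (r ∷ rs) (Ur ∷ Urs) (r-apart ∷ rs-apart) =
    (r≢r′ ∷ All.tabulate r-fresh) ∷ All.tabulate r′-fresh ∷ Unique-pairing rs Urs rs-apart
    where
    Ur′  = proj₁ (proj₂ (partner r Ur))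
    Rrr′ = proj₁ (proj₂ (proj₂ (partner r Ur)))
    r≢r′ = proj₁ (proj₂ (proj₂ (proj₂ (partner r Ur))))
    related : ∀ {v} → v ∈ elems (pairing rs Urs) → ∃ λ s → s ∈ rs × U s × U v × R s v
    related v∈ with ∈-elems⁻ (pairing rs Urs) v∈
    ... | pr , pr∈ , v∈pr =
      let (Us , Uv , Rsv) = related-to-first pr∈ v∈pr in proj₁ pr , proj₁ (∈-pairing⁻ pr∈) , Us , Uv , Rsv
    r-fresh : ∀ {v} → v ∈ elems (pairing rs Urs) → r ≢ v
    r-fresh v∈ refl with related v∈
    ... | s , s∈ , Us , _ , Rsr = All.lookup r-apart s∈ (R-sym Us Ur Rsr)
    r′-fresh : ∀ {v} → v ∈ elems (pairing rs Urs) → proj₁ (partner r Ur) ≢ v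
    r′-fresh v∈ refl with related v∈
    ... | s , s∈ , Us , _ , Rsr′ = All.lookup r-apart s∈ (R-trans Ur Ur′ Us Rrr′ (R-sym Us Ur′ Rsr′))

  cover-pairing : {x : ℕ} (rs : List ℕ) (Urs : All U rs) → U x → Any (R x) rs → x ∈ elems (pairing rs Urs)
  cover-pairing {x} (r ∷ rs) (Ur ∷ Urs) Ux (here Rxr) with proj₂ (proj₂ (proj₂ (proj₂ (partner r Ur)))) x Ux (R-sym Ux Ur Rxr)
  ... | here x≡r         = here x≡r
  ... | there (here x≡r′) = there (here x≡r′)
  cover-pairing (r ∷ rs) (Ur ∷ Urs) Ux (there x∼rs) = there (there (cover-pairing rs Urs Ux x∼rs))

  private
    reps   = proj₁ (proj₁ (proj₂ C))
    reps⊆U = proj₁ (proj₂ (proj₁ (proj₂ C)))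
    apart  = proj₁ (proj₂ (proj₂ (proj₁ (proj₂ C))))
    cover  = proj₁ (proj₂ (proj₂ (proj₂ (proj₁ (proj₂ C)))))
    |reps| = proj₂ (proj₂ (proj₂ (proj₂ (proj₁ (proj₂ C)))))
    R-family = proj₂ (proj₂ (proj₂ C))

  P : Pairing
  P = pairing reps reps⊆U

  U⇔P : ∀ x → U x ⇔′ x ∈ elems P
  U⇔P x = (λ Ux → cover-pairing reps reps⊆U Ux (cover x Ux)) ,
          (λ x∈P → let (pr , pr∈ , x∈pr) = ∈-elems⁻ P x∈P in proj₁ (proj₂ (related-to-first pr∈ x∈pr)))

  R⇔SamePair : ∀ x y → U x → U y → R x y ⇔′ SamePair P x y
  R⇔SamePair x y Ux Uy = to , from
    where
    to : R x y → SamePair P x y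
    to Rxy with ∈-elems⁻ P (proj₁ (U⇔P x) Ux)
    ... | pr , pr∈ , x∈pr with related-to-first pr∈ x∈pr | ∈-pairing⁻ pr∈
    ...   | Ur , _ , Rrx | _ , _ , _ , _ , _ , closed = lose pr∈ (x∈pr , closed y Uy (R-trans Ur Ux Uy Rrx Rxy))
    from : SamePair P x y → R x y
    from same with find same
    ... | pr , pr∈ , x∈pr , y∈pr with related-to-first pr∈ x∈pr | related-to-first pr∈ y∈pr
    ...   | Ur , _ , Rrx | _ , _ , Rry = R-trans Ux Ur Uy (R-sym Ur Ux Rrx) Rry

  transversalFamily : IsTransversalFamilyOf P α F
  transversalFamily = !P , |P| , F≡T
    where
    !P : Unique (elems P)
    !P = Unique-pairing reps reps⊆U apart
    |P| : length P ≡ α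
    |P| = trans (length-pairing reps reps⊆U) |reps|
    open SamePairClasses P !P U⇔P using (IsClassTransversal⇔IsTransversal)
    SamePair⇔R : ∀ x y → U x → U y → SamePair P x y ⇔′ R x y
    SamePair⇔R x y Ux Uy = proj₂ (R⇔SamePair x y Ux Uy) , proj₁ (R⇔SamePair x y Ux Uy)
    F≡T : ∀ B → B ∈ᶜ F ⇔′ IsTransversal P B
    F≡T B =
      (λ B∈F → proj₁ (IsClassTransversal⇔IsTransversal B)
                 (subst (λ k → IsClassTransversal U (SamePair P) k B) (sym |P|)
                   (IsClassTransversal-cong R⇔SamePair (proj₁ (R-family B) B∈F)))) ,
      (λ B-tr → proj₂ (R-family B) (IsClassTransversal-cong SamePair⇔R
                 (subst (λ k → IsClassTransversal U (SamePair P) k B) |P|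
                   (proj₂ (IsClassTransversal⇔IsTransversal B) B-tr))))

mainTheorem16 : (F : Collection) (α : ℕ) → Relevant F α →
    (MaximalHke F ⇔′
      (HasCard (⋃ F) (2 * α) ×
       Σ (ℕ → ℕ → Set) λ R → IsEquivOn (⋃ F) R × NumClasses (⋃ F) R α ×
         ClassesOfSizeTwo (⋃ F) R × IsTransversalFamily F (⋃ F) R α))
    ×
    (MaximalHke F ⇔′
      (HasCard (⋃ F) (2 * α) ×
       IsEquivOn (⋃ F) ≈[ F ] × NumClasses (⋃ F) ≈[ F ] α ×
       ClassesOfSizeTwo (⋃ F) ≈[ F ] × IsTransversalFamily F (⋃ F) ≈[ F ] α))
mainTheorem16 F α relevant = (to-classes , from-classes) , (to-≈ , from-≈)
  where
  to-classes : MaximalHke F → HasCard (⋃ F) (2 * α) × Σ (ℕ → ℕ → Set) (PairClasses F α)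
  to-classes maximal =
    let (P , T) = MaximalHke⇒transversalFamily relevant maximal
    in transversalFamily-|⋃| T , SamePair P , transversalFamily⇒PairClasses T

  from-classes : HasCard (⋃ F) (2 * α) × Σ (ℕ → ℕ → Set) (PairClasses F α) → MaximalHke F
  from-classes (_ , R , classes) = transversalFamily⇒MaximalHke relevant (ClassPairing.transversalFamily classes)

  to-≈ : MaximalHke F → HasCard (⋃ F) (2 * α) × PairClasses F α ≈[ F ]
  to-≈ maximal =
    let (P , T) = MaximalHke⇒transversalFamily relevant maximal
    in transversalFamily-|⋃| T , PairClasses-cong (≈⇔SamePair T) (transversalFamily⇒PairClasses T)

  from-≈ : HasCard (⋃ F) (2 * α) × PairClasses F α ≈[ F ] → MaximalHke F
  from-≈ (_ , classes) = transversalFamily⇒MaximalHke relevant (ClassPairing.transversalFamily classes)
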